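{- Let $(\nabla,s)$ and $(\nabla,t)$ be NLA-terms-in-context and $X$ a term-variable not occurring in $\nabla,s,t$. If there is a derivation $\{X:t\triangleq s\};\emptyset;\emptyset;\mathit{Id}\Rightarrow^{+}\emptyset;S;\Gamma;\sigma$ of $\mathrm{NAU}_E$, then $(\Gamma,X\sigma)$ is an $E$-generalization of $(\nabla,t)$ and $(\nabla,s)$.
   Context: Ground language. Fix a countably infinite set $\mathbb{A}$ of atoms and a signature $\Sigma=\Sigma_\emptyset\sqcup\Sigma_{A}\sqcup\Sigma_{C}\sqcup\Sigma_{AC}$ of function symbols with arities, where the symbols of $\Sigma_A,\Sigma_C,\Sigma_{AC}$ are binary. Ground terms: $S::=a\mid f(S_1,\dots,S_n)\mid\lambda a.S$. Ground permutations are finite-support bijections of $\mathbb{A}$, acting by $\pi\cdot a=\pi(a)$, $\pi\cdot f(S_1,\dots,S_n)=f(\pi\cdot S_1,\dots,\pi\cdot S_n)$, $\pi\cdot\lambda a.S=\lambda\pi(a).\pi\cdot S$. Freshness $a\#S$ means $a$ does not occur free in $S$. $\approx_E$ is the least congruence on ground terms containing $\alpha$-equivalence ($\lambda a.S\approx\lambda b.T$ if $S\approx(a\,b)\cdot T$ and $a\#T$), commutativity $f(S_1,S_2)=f(S_2,S_1)$ for $f\in\Sigma_C\cup\Sigma_{AC}$ and associativity $f(f(S_1,S_2),S_3)=f(S_1,f(S_2,S_3))$ for $f\in\Sigma_A\cup\Sigma_{AC}$; $[S]_E$ is the $\approx_E$-class. Associative/AC applications are written flattened $f(t_1,\dots,t_n)$,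 $n\ge2$, with $f(t)$ standing for $t$. $E$ is one of: no equational symbols, or only associative, only commutative, or only AC symbols besides free ones. NLA-language. Disjoint countably infinite sets of term-variables $X,Y,Z,\dots$ and atom-variables $A,B,C,\dots$. NLA-terms: $s::=W\mid\pi\cdot X\mid f(s_1,\dots,s_n)\mid\lambda W.s$, $W::=\pi\cdot A$, $\pi::=\mathit{id}\mid(W_1\,W_2)\circ\pi$. Substitutions map term-variables to NLA-terms and atom-variables to atom suspensions (postfix notation). An interpretation $\rho$ maps atom-variables to atoms (not necessarily injectively) and term-variables to ground terms, extended homomorphically ($(W_1\,W_2)\circ\pi$ becomes the swapping $(W_1\rho\;W_2\rho)$ composed with $\pi\rho$). Freshness constraints $W\#s$; a freshness context is a finite set of them; $\Gamma\rho$ holds if all $W\rho\#s\rho$ hold. $\Gamma\models s\approx_E t$ (resp. $\Gamma\models\pi_1\cdot A=\pi_2\cdot B$) means: for every $\rho$ with $\Gamma\rho$ holding, $s\rho\approx_E t\rho$ (resp. the atoms coincide). A term-in-context is a pair $(\nabla,s)$; its semantics is $[\![\nabla,s]\!]=\{[s\rho]_E\mid\rho\text{ an interpretation with }\nabla\rho\text{ holding}\}$. $(\nabla,r)$ is an $E$-generalization of $(\nabla_1,s)$ and $(\nabla_2,t)$ iff $[\![\nabla_1,s]\!]\subseteq[\![\nabla,r]\!]$ and $[\![\nabla_2,t]\!]\subseteq[\![\nabla,r]\!]$. The system $\mathrm{NAU}_E$ works on states $P;S;\Gamma;\sigma$ ($P$ a set of equations $X:t\triangleq s$ with $X$ a term-variable;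 $S$ a store of such equations or of $C:\pi_1\cdot A\triangleq\pi_2\cdot B$ with $C$ an atom-variable; $\Gamma$ a freshness context; $\sigma$ a substitution). "Fresh"/"new" variables occur nowhere else. Rules (nondeterministic): Dec: $\{X:f(t_1..t_m)\triangleq f(s_1..s_m)\}\dot\cup P;S;\Gamma;\sigma\Rightarrow\{Y_i:t_i\triangleq s_i\}_i\cup P;S;\Gamma;\sigma\{X\mapsto f(Y_1..Y_m)\}$, $Y_i$ fresh. Abs: $\{X:\lambda W_1.t\triangleq\lambda W_2.s\}\dot\cup P;S;\Gamma;\sigma\Rightarrow\{Y:(W_1\,C)\cdot t\triangleq(W_2\,C)\cdot s\}\cup P;S;\Gamma\cup\{C\#\lambda W_1.t,C\#\lambda W_2.s\};\sigma\{X\mapsto\lambda C.Y\}$, $Y$ fresh, $C$ a new atom-variable. SusAA: remove $X:\pi_1\cdot A\triangleq\pi_2\cdot B$, extend $\sigma$ by $X\mapsto\pi_1\cdot A$, if $\Gamma\models\pi_1\cdot A=\pi_2\cdot B$. SusYY: remove $X:\pi_1\cdot Y\triangleq\pi_2\cdot Y$, extend $\sigma$ by $X\mapsto\pi_1\cdot Y$, if $\Gamma\models\pi_1\cdot Y\approx_E\pi_2\cdot Y$. SolAB: if $\Gamma\not\models\pi_1\cdot A=\pi_2\cdot B$: remove $X:\pi_1\cdot A\triangleq\pi_2\cdot B$ from $P$, add $C:\pi_1\cdot A\triangleq\pi_2\cdot B$ to $S$, add $C\#\lambda\pi_1\cdot A.\lambda\pi_2\cdot B.C$ to $\Gamma$,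 extend $\sigma$ by $X\mapsto C$ ($C$ new). Sol: move $X:t\triangleq s$ from $P$ to $S$ when none of Dec, Abs, SusAA, SusYY, SolAB applies. Mer: $\emptyset;\{Z_1:t_1\triangleq s_1,Z_2:t_2\triangleq s_2\}\dot\cup S;\Gamma;\sigma\Rightarrow\emptyset;\{Z_1:t_1\triangleq s_1\}\cup S;\Gamma\{Z_2\mapsto\pi\cdot Z_1\};\sigma\{Z_2\mapsto\pi\cdot Z_1\}$, $Z_1,Z_2$ both atom- or both term-variables, $\pi$ an atom-variable permutation computed by an equivariance procedure on $t_1\rhd t_2$, $s_1\rhd s_2$ under $\Gamma$, satisfying $\Gamma\models\pi\cdot t_1\approx_E t_2$ and $\Gamma\models\pi\cdot s_1\approx_E s_2$. DecA ($f$ associative, $n,m\ge2$, any $1\le k<n,1\le l<m$): replace $X:f(t_1..t_n)\triangleq f(s_1..s_m)$ by $Y_1:f(t_1..t_k)\triangleq f(s_1..s_l)$, $Y_2:f(t_{k+1}..t_n)\triangleq f(s_{l+1}..s_m)$; extend $\sigma$ by $X\mapsto f(Y_1,Y_2)$. DecC ($f$ commutative, $i\in\{1,2\}$): replace $X:f(t_1,t_2)\triangleq f(s_1,s_2)$ by $Y_1:t_1\triangleq s_i$, $Y_2:t_2\triangleq s_{3-i}$; extend $\sigma$ by $X\mapsto f(Y_1,Y_2)$. DecAC ($f$ AC): as DecA after arbitrary reorderings of the arguments of both sides. -}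

module Defs where

open import Data.Nat using (ℕ; _≟_)
open import Data.Bool using (if_then_else_)
open import Data.Fin using (Fin)
open import Data.Vec using (Vec; []; _∷_; lookup)
import Data.Vec as Vec
open import Data.Vec.Relation.Binary.Pointwise.Inductive using (Pointwise)
import Data.Vec.Relation.Unary.All as VAll
import Data.Vec.Relation.Unary.Any as VAny
open import Data.List using (List; []; _∷_; _++_)
import Data.List as List
open import Data.List.NonEmpty using (List⁺; toList; foldr₁)
open import Data.List.Relation.Unary.All using (All)
open import Data.List.Relation.Unary.Any using (Any)
open import Data.List.Relation.Binary.Permutation.Propositional using (_↭_)
open import Data.Product using (_×_; _,_; ∃; Σ)
open import Data.Sum using (_⊎_)
open import Data.Empty using (⊥)
open import Data.Unit using (⊤)
open import Relation.Nullary using (¬_; does)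
open import Relation.Binary.PropositionalEquality using (_≡_; _≢_)

-- Equational theories E: the equational (binary) symbols are all
-- associative (thA), all commutative (thC) or all AC (thAC).
-- The case "no equational symbols" is the case ESym empty.

data Theory : Set where
  thA thC thAC : Theory

IsAssoc : Theory → Set
IsAssoc thA  = ⊤
IsAssoc thC  = ⊥
IsAssoc thAC = ⊤

IsComm : Theory → Set
IsComm thA  = ⊥
IsComm thC  = ⊤
IsComm thAC = ⊤

record Signature : Set₁ where
  field
    FSym   : Set
    farity : FSym → ℕ
    ESym   : Set
    theory : Theory

-- Atoms (countably infinite) and ground permutations (lists of swappings,
-- read as compositions: (a b) ∷ p  means  (a b) ∘ p)

Atom : Set
Atom = ℕ

swapA : Atom → Atom → Atom → Atom
swapA a b c = if does (c ≟ a) then b else (if does (c ≟ b) then a else c)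

GPerm : Set
GPerm = List (Atom × Atom)

actA : GPerm → Atom → Atom
actA [] c = c
actA ((a , b) ∷ p) c = swapA a b (actA p c)

module Lang (Sg : Signature) where
  open Signature Sg

  data GTerm : Set where
    gatom : Atom → GTerm
    gfapp : (f : FSym) → Vec GTerm (farity f) → GTerm
    geapp : ESym → GTerm → GTerm → GTerm
    glam  : Atom → GTerm → GTerm

  actG  : GPerm → GTerm → GTerm
  actGs : ∀ {n} → GPerm → Vec GTerm n → Vec GTerm n
  actG p (gatom a) = gatom (actA p a)
  actG p (gfapp f ts) = gfapp f (actGs p ts)
  actG p (geapp f s t) = geapp f (actG p s) (actG p t)
  actG p (glam a t) = glam (actA p a) (actG p t)
  actGs p [] = []
  actGs p (t ∷ ts) = actG p t ∷ actGs p ts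

  data _#g_ (a : Atom) : GTerm → Set where
    #atom : ∀ {b} → a ≢ b → a #g gatom b
    #fapp : ∀ {f ts} → VAll.All (a #g_) ts → a #g gfapp f ts
    #eapp : ∀ {f s t} → a #g s → a #g t → a #g geapp f s t
    #lam= : ∀ {t} → a #g glam a t
    #lam  : ∀ {b t} → a #g t → a #g glam b t

  data _≈E_ : GTerm → GTerm → Set where
    ≈refl  : ∀ {S} → S ≈E S
    ≈sym   : ∀ {S T} → S ≈E T → T ≈E S
    ≈trans : ∀ {S T U} → S ≈E T → T ≈E U → S ≈E U
    ≈fapp  : ∀ {f ss ts} → Pointwise _≈E_ ss ts → gfapp f ss ≈E gfapp f ts
    ≈eapp  : ∀ {f S₁ S₂ T₁ T₂} → S₁ ≈E T₁ → S₂ ≈E T₂ →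
             geapp f S₁ S₂ ≈E geapp f T₁ T₂
    ≈lam   : ∀ {a S T} → S ≈E T → glam a S ≈E glam a T
    ≈α     : ∀ {a b S T} → a #g T → S ≈E actG ((a , b) ∷ []) T →
             glam a S ≈E glam b T
    ≈comm  : ∀ {f S₁ S₂} → IsComm theory → geapp f S₁ S₂ ≈E geapp f S₂ S₁
    ≈assoc : ∀ {f S₁ S₂ S₃} → IsAssoc theory →
             geapp f (geapp f S₁ S₂) S₃ ≈E geapp f S₁ (geapp f S₂ S₃)

  -- NLA-terms.  Term- and atom-variables are numbered by ℕ; they live in
  -- different syntactic positions, hence are disjoint sorts.

  data Perm  : Set
  data ASusp : Set

  data Perm where
    pid   : Perm
    pswap : ASusp → ASusp → Perm → Perm

  data ASusp where
    _·_ : Perm → ℕ → ASusp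

  data Term : Set where
    atm   : ASusp → Term
    susp  : Perm → ℕ → Term
    nfapp : (f : FSym) → Vec Term (farity f) → Term
    neapp : ESym → Term → Term → Term
    lam   : ASusp → Term → Term

  _∘p_ : Perm → Perm → Perm
  pid ∘p q = q
  pswap W₁ W₂ p ∘p q = pswap W₁ W₂ (p ∘p q)

  _·W_ : Perm → ASusp → ASusp
  p ·W (q · A) = (p ∘p q) · A

  _·t_  : Perm → Term → Term
  actTs : ∀ {n} → Perm → Vec Term n → Vec Term n
  p ·t atm W = atm (p ·W W)
  p ·t susp q X = susp (p ∘p q) X
  p ·t nfapp f ts = nfapp f (actTs p ts)
  p ·t neapp f s t = neapp f (p ·t s) (p ·t t)
  p ·t lam W t = lam (p ·W W) (p ·t t)
  actTs p [] = []
  actTs p (t ∷ ts) = (p ·t t) ∷ actTs p ts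

  -- Substitutions (postfix application, composition σ ⨾ θ = "σθ")

  record Subst : Set where
    field
      tv : ℕ → Term
      av : ℕ → ASusp
  open Subst public

  substP : Perm → Subst → Perm
  substW : ASusp → Subst → ASusp
  substP pid σ = pid
  substP (pswap W₁ W₂ p) σ = pswap (substW W₁ σ) (substW W₂ σ) (substP p σ)
  substW (p · A) σ = substP p σ ·W av σ A

  substT  : Term → Subst → Term
  substTs : ∀ {n} → Vec Term n → Subst → Vec Term n
  substT (atm W) σ = atm (substW W σ)
  substT (susp p X) σ = substP p σ ·t tv σ X
  substT (nfapp f ts) σ = nfapp f (substTs ts σ)
  substT (neapp f s t) σ = neapp f (substT s σ) (substT t σ)
  substT (lam W t) σ = lam (substW W σ) (substT t σ)
  substTs [] σ = []
  substTs (t ∷ ts) σ = substT t σ ∷ substTs ts σ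

  Id : Subst
  Id = record { tv = susp pid ; av = pid ·_ }

  _⨾_ : Subst → Subst → Subst
  σ ⨾ θ = record { tv = λ X → substT (tv σ X) θ ; av = λ A → substW (av σ A) θ }

  [_↦t_] : ℕ → Term → Subst
  [ X ↦t u ] = record { tv = λ Y → if does (Y ≟ X) then u else susp pid Y
                      ; av = pid ·_ }

  [_↦a_] : ℕ → ASusp → Subst
  [ A ↦a W ] = record { tv = susp pid
                      ; av = λ B → if does (B ≟ A) then W else pid · B }

  FC : Set
  FC = ASusp × Term

  Ctx : Set
  Ctx = List FC

  substCtx : Ctx → Subst → Ctx
  substCtx Γ σ = List.map (λ { (W , s) → (substW W σ , substT s σ) }) Γ

  record Interp : Set where
    field
      aρ : ℕ → Atom
      tρ : ℕ → GTerm
  open Interp public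

  ⟦_⟧P : Perm → Interp → GPerm
  ⟦_⟧W : ASusp → Interp → Atom
  ⟦ pid ⟧P ρ = []
  ⟦ pswap W₁ W₂ p ⟧P ρ = (⟦ W₁ ⟧W ρ , ⟦ W₂ ⟧W ρ) ∷ ⟦ p ⟧P ρ
  ⟦ p · A ⟧W ρ = actA (⟦ p ⟧P ρ) (aρ ρ A)

  ⟦_⟧T  : Term → Interp → GTerm
  ⟦_⟧Ts : ∀ {n} → Vec Term n → Interp → Vec GTerm n
  ⟦ atm W ⟧T ρ = gatom (⟦ W ⟧W ρ)
  ⟦ susp p X ⟧T ρ = actG (⟦ p ⟧P ρ) (tρ ρ X)
  ⟦ nfapp f ts ⟧T ρ = gfapp f (⟦ ts ⟧Ts ρ)
  ⟦ neapp f s t ⟧T ρ = geapp f (⟦ s ⟧T ρ) (⟦ t ⟧T ρ)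
  ⟦ lam W t ⟧T ρ = glam (⟦ W ⟧W ρ) (⟦ t ⟧T ρ)
  ⟦ [] ⟧Ts ρ = []
  ⟦ t ∷ ts ⟧Ts ρ = ⟦ t ⟧T ρ ∷ ⟦ ts ⟧Ts ρ

  HoldsFC : FC → Interp → Set
  HoldsFC (W , s) ρ = ⟦ W ⟧W ρ #g ⟦ s ⟧T ρ

  Holds : Ctx → Interp → Set
  Holds Γ ρ = All (λ c → HoldsFC c ρ) Γ

  _⊨_≈_ : Ctx → Term → Term → Set
  Γ ⊨ s ≈ t = ∀ ρ → Holds Γ ρ → ⟦ s ⟧T ρ ≈E ⟦ t ⟧T ρ

  _⊨_=a_ : Ctx → ASusp → ASusp → Set
  Γ ⊨ W₁ =a W₂ = ∀ ρ → Holds Γ ρ → ⟦ W₁ ⟧W ρ ≡ ⟦ W₂ ⟧W ρ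

  -- Semantics of terms-in-context and E-generalization.
  -- ⟦ ∇ , s ⟧ S  expresses  [S]_E ∈ ⟦∇,s⟧ = { [sρ]_E | ∇ρ holds }.

  ⟦_,_⟧ : Ctx → Term → GTerm → Set
  ⟦ ∇ , s ⟧ S = ∃ λ ρ → Holds ∇ ρ × (⟦ s ⟧T ρ ≈E S)

  _⊆⟦⟧_ : (Ctx × Term) → (Ctx × Term) → Set
  (∇₁ , s) ⊆⟦⟧ (∇ , r) = ∀ S → ⟦ ∇₁ , s ⟧ S → ⟦ ∇ , r ⟧ S

  IsEGeneralization : (Ctx × Term) → (Ctx × Term) → (Ctx × Term) → Set
  IsEGeneralization g a b = (a ⊆⟦⟧ g) × (b ⊆⟦⟧ g)

  data Var : Set where
    tvar avar : ℕ → Var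

  data OccP (v : Var) : Perm → Set
  data OccW (v : Var) : ASusp → Set
  data OccP v where
    occ₁ : ∀ {W₁ W₂ p} → OccW v W₁ → OccP v (pswap W₁ W₂ p)
    occ₂ : ∀ {W₁ W₂ p} → OccW v W₂ → OccP v (pswap W₁ W₂ p)
    occ₃ : ∀ {W₁ W₂ p} → OccP v p → OccP v (pswap W₁ W₂ p)
  data OccW v where
    occPerm : ∀ {p A} → OccP v p → OccW v (p · A)
    occVar  : ∀ {p A} → v ≡ avar A → OccW v (p · A)

  data OccT (v : Var) : Term → Set where
    occAtm   : ∀ {W} → OccW v W → OccT v (atm W)
    occSuspP : ∀ {p X} → OccP v p → OccT v (susp p X)
    occSuspX : ∀ {p X} → v ≡ tvar X → OccT v (susp p X)
    occFapp  : ∀ {f ts} → VAny.Any (OccT v) ts → OccT v (nfapp f ts)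
    occEappl : ∀ {f s t} → OccT v s → OccT v (neapp f s t)
    occEappr : ∀ {f s t} → OccT v t → OccT v (neapp f s t)
    occLamW  : ∀ {W t} → OccW v W → OccT v (lam W t)
    occLamT  : ∀ {W t} → OccT v t → OccT v (lam W t)

  OccFC : Var → FC → Set
  OccFC v (W , s) = OccW v W ⊎ OccT v s

  OccSubst : Var → Subst → Set
  OccSubst v σ =
      (∃ λ X → ¬ (tv σ X ≡ susp pid X) × (v ≡ tvar X ⊎ OccT v (tv σ X)))
    ⊎ (∃ λ A → ¬ (av σ A ≡ pid · A) × (v ≡ avar A ⊎ OccW v (av σ A)))

  data PEq : Set where
    _∶_≜_ : ℕ → Term → Term → PEq

  data SEq : Set where
    teq : ℕ → Term → Term → SEq
    aeq : ℕ → ASusp → ASusp → SEq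

  OccPEq : Var → PEq → Set
  OccPEq v (X ∶ t ≜ s) = (v ≡ tvar X) ⊎ OccT v t ⊎ OccT v s

  OccSEq : Var → SEq → Set
  OccSEq v (teq X t s) = (v ≡ tvar X) ⊎ OccT v t ⊎ OccT v s
  OccSEq v (aeq C W₁ W₂) = (v ≡ avar C) ⊎ OccW v W₁ ⊎ OccW v W₂

  record State : Set where
    constructor ⟨_,_,_,_⟩
    field
      P : List PEq
      S : List SEq
      Γ : Ctx
      σ : Subst

  OccState : Var → State → Set
  OccState v ⟨ P , S , Γ , σ ⟩ =
    Any (OccPEq v) P ⊎ Any (OccSEq v) S ⊎ Any (OccFC v) Γ ⊎ OccSubst v σ

  Fresh : Var → State → Set
  Fresh v st = ¬ OccState v st

  decEqs : ∀ {n} → Vec ℕ n → Vec Term n → Vec Term n → List PEq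
  decEqs [] [] [] = []
  decEqs (Y ∷ Ys) (t ∷ ts) (s ∷ ss) = (Y ∶ t ≜ s) ∷ decEqs Ys ts ss

  swp : ASusp → ℕ → Perm
  swp W C = pswap W (pid · C) pid

  -- flattening w.r.t. an equational symbol f: Flat f t [t₁,…,tₙ] iff
  -- t is f(t₁,…,tₙ) in flattened notation
  data Flat (f : ESym) : Term → List Term → Set where
    fleaf : ∀ {t} → (∀ a b → t ≢ neapp f a b) → Flat f t (t ∷ [])
    fnode : ∀ {a b as bs} → Flat f a as → Flat f b bs →
            Flat f (neapp f a b) (as ++ bs)

  -- f(t₁,…,tₖ) for k ≥ 1 (f(t) stands for t), right-nested
  build : ESym → List⁺ Term → Term
  build f = foldr₁ (neapp f)

  -- "one of Dec, Abs, SusAA, SusYY, SolAB applies to X : t ≜ s"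
  data Applicable (Γ : Ctx) : Term → Term → Set where
    aDec   : ∀ {f ts ss} → Applicable Γ (nfapp f ts) (nfapp f ss)
    aAbs   : ∀ {W₁ W₂ t s} → Applicable Γ (lam W₁ t) (lam W₂ s)
    aSusAA : ∀ {W₁ W₂} → Γ ⊨ W₁ =a W₂ → Applicable Γ (atm W₁) (atm W₂)
    aSolAB : ∀ {W₁ W₂} → ¬ (Γ ⊨ W₁ =a W₂) → Applicable Γ (atm W₁) (atm W₂)
    aSusYY : ∀ {p₁ p₂ Y} → Γ ⊨ susp p₁ Y ≈ susp p₂ Y →
             Applicable Γ (susp p₁ Y) (susp p₂ Y)

  data _⇒_ : State → State → Set where
    Dec : ∀ {P P' S Γ σ X f ts ss} (Ys : Vec ℕ (farity f)) →
      P ↭ ((X ∶ nfapp f ts ≜ nfapp f ss) ∷ P') →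
      (∀ i → Fresh (tvar (lookup Ys i)) ⟨ P , S , Γ , σ ⟩) →
      (∀ i j → lookup Ys i ≡ lookup Ys j → i ≡ j) →
      ⟨ P , S , Γ , σ ⟩ ⇒
      ⟨ decEqs Ys ts ss ++ P' , S , Γ
      , σ ⨾ [ X ↦t nfapp f (Vec.map (susp pid) Ys) ] ⟩
    Abs : ∀ {P P' S Γ σ X W₁ W₂ t s} (Y C : ℕ) →
      P ↭ ((X ∶ lam W₁ t ≜ lam W₂ s) ∷ P') →
      Fresh (tvar Y) ⟨ P , S , Γ , σ ⟩ →
      Fresh (avar C) ⟨ P , S , Γ , σ ⟩ →
      ⟨ P , S , Γ , σ ⟩ ⇒
      ⟨ (Y ∶ (swp W₁ C ·t t) ≜ (swp W₂ C ·t s)) ∷ P' , S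
      , Γ ++ ((pid · C , lam W₁ t) ∷ (pid · C , lam W₂ s) ∷ [])
      , σ ⨾ [ X ↦t lam (pid · C) (susp pid Y) ] ⟩
    SusAA : ∀ {P P' S Γ σ X W₁ W₂} →
      P ↭ ((X ∶ atm W₁ ≜ atm W₂) ∷ P') →
      Γ ⊨ W₁ =a W₂ →
      ⟨ P , S , Γ , σ ⟩ ⇒ ⟨ P' , S , Γ , σ ⨾ [ X ↦t atm W₁ ] ⟩
    SusYY : ∀ {P P' S Γ σ X p₁ p₂ Y} →
      P ↭ ((X ∶ susp p₁ Y ≜ susp p₂ Y) ∷ P') →
      Γ ⊨ susp p₁ Y ≈ susp p₂ Y →
      ⟨ P , S , Γ , σ ⟩ ⇒ ⟨ P' , S , Γ , σ ⨾ [ X ↦t susp p₁ Y ] ⟩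
    SolAB : ∀ {P P' S Γ σ X W₁ W₂} (C : ℕ) →
      P ↭ ((X ∶ atm W₁ ≜ atm W₂) ∷ P') →
      ¬ (Γ ⊨ W₁ =a W₂) →
      Fresh (avar C) ⟨ P , S , Γ , σ ⟩ →
      ⟨ P , S , Γ , σ ⟩ ⇒
      ⟨ P' , aeq C W₁ W₂ ∷ S
      , Γ ++ ((pid · C , lam W₁ (lam W₂ (atm (pid · C)))) ∷ [])
      , σ ⨾ [ X ↦t atm (pid · C) ] ⟩
    Sol : ∀ {P P' S Γ σ X t s} →
      P ↭ ((X ∶ t ≜ s) ∷ P') →
      ¬ Applicable Γ t s →
      ⟨ P , S , Γ , σ ⟩ ⇒ ⟨ P' , teq X t s ∷ S , Γ , σ ⟩
    MerT : ∀ {S S' Γ σ Z₁ Z₂ t₁ s₁ t₂ s₂} (π : Perm) →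
      S ↭ (teq Z₁ t₁ s₁ ∷ teq Z₂ t₂ s₂ ∷ S') →
      Γ ⊨ (π ·t t₁) ≈ t₂ →
      Γ ⊨ (π ·t s₁) ≈ s₂ →
      ⟨ [] , S , Γ , σ ⟩ ⇒
      ⟨ [] , teq Z₁ t₁ s₁ ∷ S' , substCtx Γ [ Z₂ ↦t susp π Z₁ ]
      , σ ⨾ [ Z₂ ↦t susp π Z₁ ] ⟩
    MerA : ∀ {S S' Γ σ Z₁ Z₂ t₁ s₁ t₂ s₂} (π : Perm) →
      S ↭ (aeq Z₁ t₁ s₁ ∷ aeq Z₂ t₂ s₂ ∷ S') →
      Γ ⊨ (π ·W t₁) =a t₂ →
      Γ ⊨ (π ·W s₁) =a s₂ →
      ⟨ [] , S , Γ , σ ⟩ ⇒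
      ⟨ [] , aeq Z₁ t₁ s₁ ∷ S' , substCtx Γ [ Z₂ ↦a π · Z₁ ]
      , σ ⨾ [ Z₂ ↦a π · Z₁ ] ⟩
    DecA : ∀ {P P' S Γ σ X t s f ts ss} (u₁ u₂ v₁ v₂ : List⁺ Term) (Y₁ Y₂ : ℕ) →
      theory ≡ thA →
      P ↭ ((X ∶ t ≜ s) ∷ P') →
      Flat f t ts → ts ≡ toList u₁ ++ toList u₂ →
      Flat f s ss → ss ≡ toList v₁ ++ toList v₂ →
      Fresh (tvar Y₁) ⟨ P , S , Γ , σ ⟩ →
      Fresh (tvar Y₂) ⟨ P , S , Γ , σ ⟩ → Y₁ ≢ Y₂ →
      ⟨ P , S , Γ , σ ⟩ ⇒
      ⟨ (Y₁ ∶ build f u₁ ≜ build f v₁) ∷ (Y₂ ∶ build f u₂ ≜ build f v₂) ∷ P'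
      , S , Γ , σ ⨾ [ X ↦t neapp f (susp pid Y₁) (susp pid Y₂) ] ⟩
    DecC : ∀ {P P' S Γ σ X f t₁ t₂ s₁ s₂} (Y₁ Y₂ : ℕ) →
      theory ≡ thC →
      P ↭ ((X ∶ neapp f t₁ t₂ ≜ neapp f s₁ s₂) ∷ P') →
      Fresh (tvar Y₁) ⟨ P , S , Γ , σ ⟩ →
      Fresh (tvar Y₂) ⟨ P , S , Γ , σ ⟩ → Y₁ ≢ Y₂ →
      ⟨ P , S , Γ , σ ⟩ ⇒
      ⟨ (Y₁ ∶ t₁ ≜ s₁) ∷ (Y₂ ∶ t₂ ≜ s₂) ∷ P'
      , S , Γ , σ ⨾ [ X ↦t neapp f (susp pid Y₁) (susp pid Y₂) ] ⟩
    DecC' : ∀ {P P' S Γ σ X f t₁ t₂ s₁ s₂} (Y₁ Y₂ : ℕ) →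
      theory ≡ thC →
      P ↭ ((X ∶ neapp f t₁ t₂ ≜ neapp f s₁ s₂) ∷ P') →
      Fresh (tvar Y₁) ⟨ P , S , Γ , σ ⟩ →
      Fresh (tvar Y₂) ⟨ P , S , Γ , σ ⟩ → Y₁ ≢ Y₂ →
      ⟨ P , S , Γ , σ ⟩ ⇒
      ⟨ (Y₁ ∶ t₁ ≜ s₂) ∷ (Y₂ ∶ t₂ ≜ s₁) ∷ P'
      , S , Γ , σ ⨾ [ X ↦t neapp f (susp pid Y₁) (susp pid Y₂) ] ⟩
    DecAC : ∀ {P P' S Γ σ X t s f ts ss} (u₁ u₂ v₁ v₂ : List⁺ Term) (Y₁ Y₂ : ℕ) →
      theory ≡ thAC →
      P ↭ ((X ∶ t ≜ s) ∷ P') →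
      Flat f t ts → ts ↭ (toList u₁ ++ toList u₂) →
      Flat f s ss → ss ↭ (toList v₁ ++ toList v₂) →
      Fresh (tvar Y₁) ⟨ P , S , Γ , σ ⟩ →
      Fresh (tvar Y₂) ⟨ P , S , Γ , σ ⟩ → Y₁ ≢ Y₂ →
      ⟨ P , S , Γ , σ ⟩ ⇒
      ⟨ (Y₁ ∶ build f u₁ ≜ build f v₁) ∷ (Y₂ ∶ build f u₂ ≜ build f v₂) ∷ P'
      , S , Γ , σ ⨾ [ X ↦t neapp f (susp pid Y₁) (susp pid Y₂) ] ⟩

{-# OPTIONS --safe #-}
-- Fix the left side (the right one is symmetric) and an instance tρ₀ of t. Along the derivation
-- we maintain an interpretation ρ that satisfies the current context Γ, maps Xσ to tρ₀ up to ≈E,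
-- and solves every remaining equation and store entry on the left: Zρ ≈ lρ for Z : l ≜ r and
-- Cρ = W₁ρ for C : W₁ ≜ W₂. A rule introducing new variables changes ρ only there, mapping each
-- new variable to the matching part of the left side; Xσ never contains new variables, since X
-- either still labels the single equation or lies in the domain of σ. For Abs the new
-- atom-variable is mapped to an atom fresh for both abstractions, which makes the α-step and the
-- new freshness constraints hold; for SolAB, C # λW₁.λW₂.C holds because Cρ is W₁ρ. Mer keeps ρ:
-- the merged entries already give Z₂ρ ≈ (π·Z₁)ρ, and freshness is invariant under ≈E. At the end
-- ρ satisfies Γ and (Xσ)ρ ≈ tρ₀.
module Submission where

open import Defs
open import Data.Bool using (true; false; if_then_else_)
open import Data.Empty using (⊥-elim)
open import Data.Fin using (zero; suc)
open import Data.Fin.Properties using (0≢1+n; suc-injective)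
open import Data.List using (List; []; _∷_; _++_)
open import Data.List.NonEmpty using (List⁺; toList) renaming (_∷_ to _∷⁺_)
open import Data.List.Relation.Binary.Permutation.Propositional using (_↭_; ↭-sym)
  renaming (refl to ↭-refl; prep to ↭-prep; swap to ↭-swap; trans to ↭-trans)
open import Data.List.Relation.Binary.Permutation.Propositional.Properties
  using (Any-resp-↭; All-resp-↭; ↭-singleton-inv; ¬x∷xs↭[])
open import Data.List.Relation.Unary.All using (All; []; _∷_)
import Data.List.Relation.Unary.All as All
import Data.List.Relation.Unary.All.Properties as Allₚ
open import Data.List.Relation.Unary.Any using (Any; here; there)
import Data.List.Relation.Unary.Any.Properties as Anyₚ
open import Data.Maybe using (Maybe; just; nothing)
import Data.Maybe.Relation.Binary.Pointwise as Maybeᴾ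
open Maybeᴾ using (just; nothing)
open import Data.Nat using (ℕ; suc; _≟_; _≡ᵇ_; _⊔_; _<_; s≤s)
open import Data.Nat.Properties
  using (≡⇒≡ᵇ; ≡ᵇ⇒≡; <⇒≢; m⊔n<o⇒m<o; m⊔n<o⇒n<o; m≤m⊔n; m≤n⊔m)
open import Data.Product using (_×_; _,_; -,_; proj₁; proj₂; ∃; ∃₂)
open import Data.Sum using (_⊎_; inj₁; inj₂; [_,_])
import Data.Sum as Sum
open import Data.Unit using (⊤; tt)
open import Data.Vec using (Vec; []; _∷_)
import Data.Vec as Vec
import Data.Vec.Properties as Vecₚ
open import Data.Vec.Membership.Propositional.Properties using (∈-lookup)
open import Data.Vec.Relation.Binary.Pointwise.Inductive using (Pointwise; []; _∷_)
import Data.Vec.Relation.Binary.Pointwise.Extensional as Pointwiseᴱ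
import Data.Vec.Relation.Unary.All as VAll
import Data.Vec.Relation.Unary.Any as VAny
open import Function using (_∘_; case_of_)
open import Function.Definitions using (Injective)
open import Relation.Binary.Construct.Closure.Transitive as Plus using (TransClosure; _∷_)
open import Relation.Binary.PropositionalEquality
  using (_≡_; _≢_; refl; sym; trans; cong; cong₂; subst; subst₂; module ≡-Reasoning)
open import Relation.Nullary using (¬_; does; yes; no)
open ≡-Reasoning

-- does (x ≟ y) reduces to x ≡ᵇ y, so `with x ≟ y` cannot abstract it in goals about swapA and
-- substitutions; these two lemmas evaluate the conditional instead.
if-≟-≡ : ∀ {A : Set} (x y : ℕ) {u v : A} → x ≡ y → (if does (x ≟ y) then u else v) ≡ u
if-≟-≡ x .x refl with x ≡ᵇ x | ≡⇒≡ᵇ x x refl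
... | true | _ = refl

if-≟-≢ : ∀ {A : Set} (x y : ℕ) {u v : A} → x ≢ y → (if does (x ≟ y) then u else v) ≡ v
if-≟-≢ x y x≢y with x ≡ᵇ y | ≡ᵇ⇒≡ x y
... | true  | x≡y = ⊥-elim (x≢y (x≡y tt))
... | false | _   = refl

swapA-left : ∀ a b → swapA a b a ≡ b
swapA-left a b = if-≟-≡ a a refl

swapA-right : ∀ a b → swapA a b b ≡ a
swapA-right a b with b ≟ a
... | yes refl = swapA-left b b
... | no b≢a   = trans (if-≟-≢ b a b≢a) (if-≟-≡ b b refl)

swapA-other : ∀ {a b c} → c ≢ a → c ≢ b → swapA a b c ≡ c
swapA-other {a} {b} {c} c≢a c≢b = trans (if-≟-≢ c a c≢a) (if-≟-≢ c b c≢b)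

swapA-involutive : ∀ a b c → swapA a b (swapA a b c) ≡ c
swapA-involutive a b c with c ≟ a | c ≟ b
... | yes refl | _        = trans (cong (swapA c b) (swapA-left c b)) (swapA-right c b)
... | no _     | yes refl = trans (cong (swapA a c) (swapA-right a c)) (swapA-left a c)
... | no c≢a   | no c≢b   = trans (cong (swapA a b) (swapA-other c≢a c≢b)) (swapA-other c≢a c≢b)

swapA-comm : ∀ a b c → swapA a b c ≡ swapA b a c
swapA-comm a b c with c ≟ a | c ≟ b
... | yes refl | _        = trans (swapA-left c b) (sym (swapA-right b c))
... | no _     | yes refl = trans (swapA-right a c) (sym (swapA-left c a))
... | no c≢a   | no c≢b   = trans (swapA-other c≢a c≢b) (sym (swapA-other c≢b c≢a))

swapA-self : ∀ a c → swapA a a c ≡ c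
swapA-self a c with c ≟ a
... | yes refl = swapA-left c c
... | no c≢a   = swapA-other c≢a c≢a

swapA-natural : ∀ {f : Atom → Atom} → Injective _≡_ _≡_ f →
                ∀ a b c → f (swapA a b c) ≡ swapA (f a) (f b) (f c)
swapA-natural {f} f-inj a b c with c ≟ a | c ≟ b
... | yes refl | _        = trans (cong f (swapA-left c b)) (sym (swapA-left (f c) (f b)))
... | no _     | yes refl = trans (cong f (swapA-right a c)) (sym (swapA-right (f a) (f c)))
... | no c≢a   | no c≢b   = trans (cong f (swapA-other c≢a c≢b))
                                  (sym (swapA-other (c≢a ∘ f-inj) (c≢b ∘ f-inj)))

actA-++ : ∀ p q c → actA (p ++ q) c ≡ actA p (actA q c)
actA-++ []            q c = refl
actA-++ ((a , b) ∷ p) q c = cong (swapA a b) (actA-++ p q c)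

actA-injective : ∀ p → Injective _≡_ _≡_ (actA p)
actA-injective []            e = e
actA-injective ((a , b) ∷ p) e = actA-injective p
  (trans (sym (swapA-involutive a b _)) (trans (cong (swapA a b) e) (swapA-involutive a b _)))

module _ (Sg : Signature) where
  open Signature Sg
  open Lang Sg

  ≡⇒≈E : ∀ {S T} → S ≡ T → S ≈E T
  ≡⇒≈E refl = ≈refl

  actG-cong  : ∀ {p q} → (∀ c → actA p c ≡ actA q c) → ∀ T → actG p T ≡ actG q T
  actGs-cong : ∀ {p q n} → (∀ c → actA p c ≡ actA q c) →
               (Ts : Vec GTerm n) → actGs p Ts ≡ actGs q Ts
  actG-cong p≗q (gatom a)     = cong gatom (p≗q a)
  actG-cong p≗q (gfapp f Ts)  = cong (gfapp f) (actGs-cong p≗q Ts)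
  actG-cong p≗q (geapp f S T) = cong₂ (geapp f) (actG-cong p≗q S) (actG-cong p≗q T)
  actG-cong p≗q (glam a T)    = cong₂ glam (p≗q a) (actG-cong p≗q T)
  actGs-cong p≗q []       = refl
  actGs-cong p≗q (T ∷ Ts) = cong₂ _∷_ (actG-cong p≗q T) (actGs-cong p≗q Ts)

  actG-++  : ∀ p q T → actG (p ++ q) T ≡ actG p (actG q T)
  actGs-++ : ∀ {n} p q (Ts : Vec GTerm n) → actGs (p ++ q) Ts ≡ actGs p (actGs q Ts)
  actG-++ p q (gatom a)     = cong gatom (actA-++ p q a)
  actG-++ p q (gfapp f Ts)  = cong (gfapp f) (actGs-++ p q Ts)
  actG-++ p q (geapp f S T) = cong₂ (geapp f) (actG-++ p q S) (actG-++ p q T)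
  actG-++ p q (glam a T)    = cong₂ glam (actA-++ p q a) (actG-++ p q T)
  actGs-++ p q []       = refl
  actGs-++ p q (T ∷ Ts) = cong₂ _∷_ (actG-++ p q T) (actGs-++ p q Ts)

  actG-id  : ∀ T → actG [] T ≡ T
  actGs-id : ∀ {n} (Ts : Vec GTerm n) → actGs [] Ts ≡ Ts
  actG-id (gatom a)     = refl
  actG-id (gfapp f Ts)  = cong (gfapp f) (actGs-id Ts)
  actG-id (geapp f S T) = cong₂ (geapp f) (actG-id S) (actG-id T)
  actG-id (glam a T)    = cong (glam a) (actG-id T)
  actGs-id []       = refl
  actGs-id (T ∷ Ts) = cong₂ _∷_ (actG-id T) (actGs-id Ts)

  actG-swap-conj : ∀ p a b T →
    actG p (actG ((a , b) ∷ []) T) ≡ actG ((actA p a , actA p b) ∷ []) (actG p T)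
  actG-swap-conj p a b T = begin
    actG p (actG ((a , b) ∷ []) T)               ≡⟨ actG-++ p _ T ⟨
    actG (p ++ (a , b) ∷ []) T                   ≡⟨ actG-cong conj T ⟩
    actG ((actA p a , actA p b) ∷ p) T           ≡⟨ actG-++ (_ ∷ []) p T ⟩
    actG ((actA p a , actA p b) ∷ []) (actG p T) ∎
    where
    conj : ∀ c → actA (p ++ (a , b) ∷ []) c ≡ swapA (actA p a) (actA p b) (actA p c)
    conj c = trans (actA-++ p _ c) (swapA-natural (actA-injective p) a b c)

  #g-glam⁻ : ∀ {c d T} → c #g glam d T → c ≢ d → c #g T
  #g-glam⁻ #lam=      c≢c = ⊥-elim (c≢c refl)
  #g-glam⁻ (#lam c#T) _   = c#T

  #g-actG  : ∀ p {a} T → a #g T → actA p a #g actG p T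
  #gs-actG : ∀ p {a n} (Ts : Vec GTerm n) →
             VAll.All (a #g_) Ts → VAll.All (actA p a #g_) (actGs p Ts)
  #g-actG p (gatom b)     (#atom a≢b)     = #atom (a≢b ∘ actA-injective p)
  #g-actG p (gfapp f Ts)  (#fapp a#Ts)    = #fapp (#gs-actG p Ts a#Ts)
  #g-actG p (geapp f S T) (#eapp a#S a#T) = #eapp (#g-actG p S a#S) (#g-actG p T a#T)
  #g-actG p (glam a T)    #lam=           = #lam=
  #g-actG p (glam b T)    (#lam a#T)      = #lam (#g-actG p T a#T)
  #gs-actG p []       VAll.[]             = VAll.[]
  #gs-actG p (T ∷ Ts) (a#T VAll.∷ a#Ts)   = #g-actG p T a#T VAll.∷ #gs-actG p Ts a#Ts

  #g-actG⁻  : ∀ p {a} T → actA p a #g actG p T → a #g T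
  #gs-actG⁻ : ∀ p {a n} (Ts : Vec GTerm n) →
              VAll.All (actA p a #g_) (actGs p Ts) → VAll.All (a #g_) Ts
  #g-actG⁻ p (gatom b)     (#atom pa≢pb)     = #atom (pa≢pb ∘ cong (actA p))
  #g-actG⁻ p (gfapp f Ts)  (#fapp pa#Ts)     = #fapp (#gs-actG⁻ p Ts pa#Ts)
  #g-actG⁻ p (geapp f S T) (#eapp pa#S pa#T) = #eapp (#g-actG⁻ p S pa#S) (#g-actG⁻ p T pa#T)
  #g-actG⁻ p {a} (glam b T) pa# with a ≟ b
  ... | yes refl = #lam=
  ... | no a≢b   = #lam (#g-actG⁻ p T (#g-glam⁻ pa# (a≢b ∘ actA-injective p)))
  #gs-actG⁻ p []       VAll.[]             = VAll.[]
  #gs-actG⁻ p (T ∷ Ts) (pa#T VAll.∷ pa#Ts) = #g-actG⁻ p T pa#T VAll.∷ #gs-actG⁻ p Ts pa#Ts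

  ≈E-actG  : ∀ p {S T} → S ≈E T → actG p S ≈E actG p T
  ≈Es-actG : ∀ p {n} {Ss Ts : Vec GTerm n} →
             Pointwise _≈E_ Ss Ts → Pointwise _≈E_ (actGs p Ss) (actGs p Ts)
  ≈E-actG p ≈refl            = ≈refl
  ≈E-actG p (≈sym S≈T)       = ≈sym (≈E-actG p S≈T)
  ≈E-actG p (≈trans S≈T T≈U) = ≈trans (≈E-actG p S≈T) (≈E-actG p T≈U)
  ≈E-actG p (≈fapp Ss≈Ts)    = ≈fapp (≈Es-actG p Ss≈Ts)
  ≈E-actG p (≈eapp S≈T S≈T′) = ≈eapp (≈E-actG p S≈T) (≈E-actG p S≈T′)
  ≈E-actG p (≈lam S≈T)       = ≈lam (≈E-actG p S≈T)
  ≈E-actG p (≈α {a} {b} {S} {T} a#T S≈abT) =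
    ≈α (#g-actG p T a#T) (subst (actG p S ≈E_) (actG-swap-conj p a b T) (≈E-actG p S≈abT))
  ≈E-actG p (≈comm comm)     = ≈comm comm
  ≈E-actG p (≈assoc assoc)   = ≈assoc assoc
  ≈Es-actG p []              = []
  ≈Es-actG p (S≈T ∷ Ss≈Ts)   = ≈E-actG p S≈T ∷ ≈Es-actG p Ss≈Ts

  #g-resp-≈E   : ∀ {c S T} → S ≈E T → c #g S → c #g T
  #g-resp-≈E˘  : ∀ {c S T} → S ≈E T → c #g T → c #g S
  #gs-resp-≈E  : ∀ {c n} {Ss Ts : Vec GTerm n} → Pointwise _≈E_ Ss Ts →
                 VAll.All (c #g_) Ss → VAll.All (c #g_) Ts
  #gs-resp-≈E˘ : ∀ {c n} {Ss Ts : Vec GTerm n} → Pointwise _≈E_ Ss Ts →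
                 VAll.All (c #g_) Ts → VAll.All (c #g_) Ss
  #g-resp-≈E ≈refl            c# = c#
  #g-resp-≈E (≈sym T≈S)       c# = #g-resp-≈E˘ T≈S c#
  #g-resp-≈E (≈trans S≈T T≈U) c# = #g-resp-≈E T≈U (#g-resp-≈E S≈T c#)
  #g-resp-≈E (≈fapp Ss≈Ts)    (#fapp c#) = #fapp (#gs-resp-≈E Ss≈Ts c#)
  #g-resp-≈E (≈eapp S≈T S≈T′) (#eapp c#S c#S′) = #eapp (#g-resp-≈E S≈T c#S) (#g-resp-≈E S≈T′ c#S′)
  #g-resp-≈E {c} (≈lam {a} S≈T) c# with c ≟ a
  ... | yes refl = #lam=
  ... | no c≢a   = #lam (#g-resp-≈E S≈T (#g-glam⁻ c# c≢a))
  #g-resp-≈E {c} (≈α {a} {b} {S} {T} a#T S≈abT) c# with c ≟ b | c ≟ a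
  ... | yes refl | _        = #lam=
  ... | no _     | yes refl = #lam a#T
  ... | no c≢b   | no c≢a   = #lam (#g-actG⁻ ((a , b) ∷ []) T
    (subst (_#g actG ((a , b) ∷ []) T) (sym (swapA-other c≢a c≢b))
           (#g-resp-≈E S≈abT (#g-glam⁻ c# c≢a))))
  #g-resp-≈E (≈comm _)  (#eapp c#S c#T)             = #eapp c#T c#S
  #g-resp-≈E (≈assoc _) (#eapp (#eapp c#S c#T) c#U) = #eapp c#S (#eapp c#T c#U)
  #g-resp-≈E˘ ≈refl            c# = c#
  #g-resp-≈E˘ (≈sym T≈S)       c# = #g-resp-≈E T≈S c#
  #g-resp-≈E˘ (≈trans S≈T T≈U) c# = #g-resp-≈E˘ S≈T (#g-resp-≈E˘ T≈U c#)
  #g-resp-≈E˘ (≈fapp Ss≈Ts)    (#fapp c#) = #fapp (#gs-resp-≈E˘ Ss≈Ts c#)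
  #g-resp-≈E˘ (≈eapp S≈T S≈T′) (#eapp c#T c#T′) =
    #eapp (#g-resp-≈E˘ S≈T c#T) (#g-resp-≈E˘ S≈T′ c#T′)
  #g-resp-≈E˘ {c} (≈lam {a} S≈T) c# with c ≟ a
  ... | yes refl = #lam=
  ... | no c≢a   = #lam (#g-resp-≈E˘ S≈T (#g-glam⁻ c# c≢a))
  #g-resp-≈E˘ {c} (≈α {a} {b} {S} {T} a#T S≈abT) c# with c ≟ a | c ≟ b
  ... | yes refl | _        = #lam=
  ... | no c≢a   | yes refl = #lam (#g-resp-≈E˘ S≈abT
    (subst (_#g actG ((a , c) ∷ []) T) (swapA-left a c) (#g-actG ((a , c) ∷ []) T a#T)))
  ... | no c≢a   | no c≢b   = #lam (#g-resp-≈E˘ S≈abT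
    (subst (_#g actG ((a , b) ∷ []) T) (swapA-other c≢a c≢b)
           (#g-actG ((a , b) ∷ []) T (#g-glam⁻ c# c≢b))))
  #g-resp-≈E˘ (≈comm _)  (#eapp c#S c#T)             = #eapp c#T c#S
  #g-resp-≈E˘ (≈assoc _) (#eapp c#S (#eapp c#T c#U)) = #eapp (#eapp c#S c#T) c#U
  #gs-resp-≈E  []            VAll.[]         = VAll.[]
  #gs-resp-≈E  (S≈T ∷ Ss≈Ts) (c# VAll.∷ c#s) = #g-resp-≈E S≈T c# VAll.∷ #gs-resp-≈E Ss≈Ts c#s
  #gs-resp-≈E˘ []            VAll.[]         = VAll.[]
  #gs-resp-≈E˘ (S≈T ∷ Ss≈Ts) (c# VAll.∷ c#s) = #g-resp-≈E˘ S≈T c# VAll.∷ #gs-resp-≈E˘ Ss≈Ts c#s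

  maxAtom  : GTerm → Atom
  maxAtoms : ∀ {n} → Vec GTerm n → Atom
  maxAtom (gatom a)     = a
  maxAtom (gfapp f Ts)  = maxAtoms Ts
  maxAtom (geapp f S T) = maxAtom S ⊔ maxAtom T
  maxAtom (glam a T)    = a ⊔ maxAtom T
  maxAtoms []           = 0
  maxAtoms (T ∷ Ts)     = maxAtom T ⊔ maxAtoms Ts

  maxAtom<⇒#g  : ∀ {c} T → maxAtom T < c → c #g T
  maxAtoms<⇒#g : ∀ {c n} (Ts : Vec GTerm n) → maxAtoms Ts < c → VAll.All (c #g_) Ts
  maxAtom<⇒#g (gatom a)     a<c = #atom (<⇒≢ a<c ∘ sym)
  maxAtom<⇒#g (gfapp f Ts)  m<c = #fapp (maxAtoms<⇒#g Ts m<c)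
  maxAtom<⇒#g (geapp f S T) m<c =
    #eapp (maxAtom<⇒#g S (m⊔n<o⇒m<o _ _ m<c)) (maxAtom<⇒#g T (m⊔n<o⇒n<o _ _ m<c))
  maxAtom<⇒#g (glam a T)    m<c = #lam (maxAtom<⇒#g T (m⊔n<o⇒n<o _ _ m<c))
  maxAtoms<⇒#g []       _   = VAll.[]
  maxAtoms<⇒#g (T ∷ Ts) m<c =
    maxAtom<⇒#g T (m⊔n<o⇒m<o _ _ m<c) VAll.∷ maxAtoms<⇒#g Ts (m⊔n<o⇒n<o _ _ m<c)

  glam-α : ∀ {c w} T → c #g glam w T → glam c (actG ((w , c) ∷ []) T) ≈E glam w T
  glam-α {c} {w} T c# with c ≟ w
  ... | yes refl = ≈lam (≡⇒≈E (trans (actG-cong (swapA-self c) T) (actG-id T)))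
  ... | no c≢w   = ≈α (#g-glam⁻ c# c≢w) (≡⇒≈E (actG-cong (swapA-comm w c) T))

  #g-bound : ∀ {a x₁ x₂} → a ≡ x₁ ⊎ a ≡ x₂ → a #g glam x₁ (glam x₂ (gatom a))
  #g-bound (inj₁ refl) = #lam=
  #g-bound (inj₂ refl) = #lam #lam=

  ⟦∘p⟧ : ∀ p q ρ → ⟦ p ∘p q ⟧P ρ ≡ ⟦ p ⟧P ρ ++ ⟦ q ⟧P ρ
  ⟦∘p⟧ pid             q ρ = refl
  ⟦∘p⟧ (pswap W₁ W₂ p) q ρ = cong (_ ∷_) (⟦∘p⟧ p q ρ)

  ⟦·W⟧ : ∀ q W ρ → ⟦ q ·W W ⟧W ρ ≡ actA (⟦ q ⟧P ρ) (⟦ W ⟧W ρ)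
  ⟦·W⟧ q (p · A) ρ = trans (cong (λ r → actA r (aρ ρ A)) (⟦∘p⟧ q p ρ)) (actA-++ (⟦ q ⟧P ρ) _ _)

  ⟦·t⟧  : ∀ q u ρ → ⟦ q ·t u ⟧T ρ ≡ actG (⟦ q ⟧P ρ) (⟦ u ⟧T ρ)
  ⟦·ts⟧ : ∀ {n} q (us : Vec Term n) ρ → ⟦ actTs q us ⟧Ts ρ ≡ actGs (⟦ q ⟧P ρ) (⟦ us ⟧Ts ρ)
  ⟦·t⟧ q (atm W)       ρ = cong gatom (⟦·W⟧ q W ρ)
  ⟦·t⟧ q (susp p X)    ρ =
    trans (cong (λ r → actG r (tρ ρ X)) (⟦∘p⟧ q p ρ)) (actG-++ (⟦ q ⟧P ρ) _ _)
  ⟦·t⟧ q (nfapp f us)  ρ = cong (gfapp f) (⟦·ts⟧ q us ρ)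
  ⟦·t⟧ q (neapp f u v) ρ = cong₂ (geapp f) (⟦·t⟧ q u ρ) (⟦·t⟧ q v ρ)
  ⟦·t⟧ q (lam W u)     ρ = cong₂ glam (⟦·W⟧ q W ρ) (⟦·t⟧ q u ρ)
  ⟦·ts⟧ q []       ρ = refl
  ⟦·ts⟧ q (u ∷ us) ρ = cong₂ _∷_ (⟦·t⟧ q u ρ) (⟦·ts⟧ q us ρ)

  ⟦⟧Ts-lookup : ∀ {n} (us : Vec Term n) i ρ → Vec.lookup (⟦ us ⟧Ts ρ) i ≡ ⟦ Vec.lookup us i ⟧T ρ
  ⟦⟧Ts-lookup (u ∷ us) zero    ρ = refl
  ⟦⟧Ts-lookup (u ∷ us) (suc i) ρ = ⟦⟧Ts-lookup us i ρ

  _⊙_ : Subst → Interp → Interp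
  θ ⊙ ρ = record { aρ = λ A → ⟦ av θ A ⟧W ρ ; tρ = λ X → ⟦ tv θ X ⟧T ρ }

  ⟦substP⟧ : ∀ p θ ρ → ⟦ substP p θ ⟧P ρ ≡ ⟦ p ⟧P (θ ⊙ ρ)
  ⟦substW⟧ : ∀ W θ ρ → ⟦ substW W θ ⟧W ρ ≡ ⟦ W ⟧W (θ ⊙ ρ)
  ⟦substP⟧ pid             θ ρ = refl
  ⟦substP⟧ (pswap W₁ W₂ p) θ ρ =
    cong₂ _∷_ (cong₂ _,_ (⟦substW⟧ W₁ θ ρ) (⟦substW⟧ W₂ θ ρ)) (⟦substP⟧ p θ ρ)
  ⟦substW⟧ (p · A) θ ρ =
    trans (⟦·W⟧ (substP p θ) (av θ A) ρ) (cong (λ r → actA r (⟦ av θ A ⟧W ρ)) (⟦substP⟧ p θ ρ))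

  ⟦substT⟧  : ∀ u θ ρ → ⟦ substT u θ ⟧T ρ ≡ ⟦ u ⟧T (θ ⊙ ρ)
  ⟦substTs⟧ : ∀ {n} (us : Vec Term n) θ ρ → ⟦ substTs us θ ⟧Ts ρ ≡ ⟦ us ⟧Ts (θ ⊙ ρ)
  ⟦substT⟧ (atm W)       θ ρ = cong gatom (⟦substW⟧ W θ ρ)
  ⟦substT⟧ (susp p X)    θ ρ =
    trans (⟦·t⟧ (substP p θ) (tv θ X) ρ) (cong (λ r → actG r (⟦ tv θ X ⟧T ρ)) (⟦substP⟧ p θ ρ))
  ⟦substT⟧ (nfapp f us)  θ ρ = cong (gfapp f) (⟦substTs⟧ us θ ρ)
  ⟦substT⟧ (neapp f u v) θ ρ = cong₂ (geapp f) (⟦substT⟧ u θ ρ) (⟦substT⟧ v θ ρ)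
  ⟦substT⟧ (lam W u)     θ ρ = cong₂ glam (⟦substW⟧ W θ ρ) (⟦substT⟧ u θ ρ)
  ⟦substTs⟧ []       θ ρ = refl
  ⟦substTs⟧ (u ∷ us) θ ρ = cong₂ _∷_ (⟦substT⟧ u θ ρ) (⟦substTs⟧ us θ ρ)

  Holds-substCtx : ∀ Γ θ ρ → Holds Γ (θ ⊙ ρ) → Holds (substCtx Γ θ) ρ
  Holds-substCtx []            θ ρ []       = []
  Holds-substCtx ((W , u) ∷ Γ) θ ρ (h ∷ hs) =
    subst₂ _#g_ (sym (⟦substW⟧ W θ ρ)) (sym (⟦substT⟧ u θ ρ)) h ∷ Holds-substCtx Γ θ ρ hs

  record Agree (O : Var → Set) (ρ₁ ρ₂ : Interp) : Set where
    field
      atoms : ∀ {A} → O (avar A) → aρ ρ₁ A ≡ aρ ρ₂ A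
      terms : ∀ {Z} → O (tvar Z) → tρ ρ₁ Z ≈E tρ ρ₂ Z
  open Agree

  Agree-refl : ∀ {O ρ} → Agree O ρ ρ
  Agree-refl = record { atoms = λ _ → refl ; terms = λ _ → ≈refl }

  Agree-trans : ∀ {O ρ₁ ρ₂ ρ₃} → Agree O ρ₁ ρ₂ → Agree O ρ₂ ρ₃ → Agree O ρ₁ ρ₃
  Agree-trans ag ag′ = record
    { atoms = λ o → trans (atoms ag o) (atoms ag′ o)
    ; terms = λ o → ≈trans (terms ag o) (terms ag′ o)
    }

  Agree-mono : ∀ {O O′ ρ₁ ρ₂} → (∀ {v} → O′ v → O v) → Agree O ρ₁ ρ₂ → Agree O′ ρ₁ ρ₂
  Agree-mono O′⊆O ag = record { atoms = atoms ag ∘ O′⊆O ; terms = terms ag ∘ O′⊆O }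

  ⟦⟧P-agree : ∀ p {ρ₁ ρ₂} → Agree (λ v → OccP v p) ρ₁ ρ₂ → ⟦ p ⟧P ρ₁ ≡ ⟦ p ⟧P ρ₂
  ⟦⟧W-agree : ∀ W {ρ₁ ρ₂} → Agree (λ v → OccW v W) ρ₁ ρ₂ → ⟦ W ⟧W ρ₁ ≡ ⟦ W ⟧W ρ₂
  ⟦⟧P-agree pid             ag = refl
  ⟦⟧P-agree (pswap W₁ W₂ p) ag = cong₂ _∷_
    (cong₂ _,_ (⟦⟧W-agree W₁ (Agree-mono occ₁ ag)) (⟦⟧W-agree W₂ (Agree-mono occ₂ ag)))
    (⟦⟧P-agree p (Agree-mono occ₃ ag))
  ⟦⟧W-agree (p · A) ag = cong₂ actA (⟦⟧P-agree p (Agree-mono occPerm ag)) (atoms ag (occVar refl))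

  ⟦⟧T-agree  : ∀ u {ρ₁ ρ₂} → Agree (λ v → OccT v u) ρ₁ ρ₂ → ⟦ u ⟧T ρ₁ ≈E ⟦ u ⟧T ρ₂
  ⟦⟧Ts-agree : ∀ {n} (us : Vec Term n) {ρ₁ ρ₂} → Agree (λ v → VAny.Any (OccT v) us) ρ₁ ρ₂ →
               Pointwise _≈E_ (⟦ us ⟧Ts ρ₁) (⟦ us ⟧Ts ρ₂)
  ⟦⟧T-agree (atm W)    ag = ≡⇒≈E (cong gatom (⟦⟧W-agree W (Agree-mono occAtm ag)))
  ⟦⟧T-agree (susp p X) {ρ₁} ag = ≈trans
    (≡⇒≈E (cong (λ r → actG r (tρ ρ₁ X)) (⟦⟧P-agree p (Agree-mono occSuspP ag))))
    (≈E-actG _ (terms ag (occSuspX refl)))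
  ⟦⟧T-agree (nfapp f us)  ag = ≈fapp (⟦⟧Ts-agree us (Agree-mono occFapp ag))
  ⟦⟧T-agree (neapp f u w) ag =
    ≈eapp (⟦⟧T-agree u (Agree-mono occEappl ag)) (⟦⟧T-agree w (Agree-mono occEappr ag))
  ⟦⟧T-agree (lam W u) {ρ₁} ag = ≈trans
    (≡⇒≈E (cong (λ a → glam a (⟦ u ⟧T ρ₁)) (⟦⟧W-agree W (Agree-mono occLamW ag))))
    (≈lam (⟦⟧T-agree u (Agree-mono occLamT ag)))
  ⟦⟧Ts-agree []       ag = []
  ⟦⟧Ts-agree (u ∷ us) ag =
    ⟦⟧T-agree u (Agree-mono VAny.here ag) ∷ ⟦⟧Ts-agree us (Agree-mono VAny.there ag)

  HoldsFC-agree : ∀ c {ρ₁ ρ₂} → Agree (λ v → OccFC v c) ρ₁ ρ₂ → HoldsFC c ρ₁ → HoldsFC c ρ₂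
  HoldsFC-agree (W , u) {ρ₂ = ρ₂} ag W#u =
    subst (_#g ⟦ u ⟧T ρ₂) (⟦⟧W-agree W (Agree-mono inj₁ ag))
          (#g-resp-≈E (⟦⟧T-agree u (Agree-mono inj₂ ag)) W#u)

  HoldsFC-fresh : ∀ {C ρ ρ′ c} u → aρ ρ′ C ≡ c → Agree (λ v → OccT v u) ρ ρ′ → c #g ⟦ u ⟧T ρ →
                  HoldsFC (pid · C , u) ρ′
  HoldsFC-fresh {ρ′ = ρ′} u C↦ ag c#u = subst (_#g ⟦ u ⟧T ρ′) (sym C↦) (#g-resp-≈E (⟦⟧T-agree u ag) c#u)

  All-agree : ∀ {A : Set} {Q : Var → A → Set} {R : Interp → A → Set} →
    (∀ {x ρ ρ′} → Agree (λ v → Q v x) ρ ρ′ → R ρ x → R ρ′ x) →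
    ∀ {xs ρ ρ′} → Agree (λ v → Any (Q v) xs) ρ ρ′ → All (R ρ) xs → All (R ρ′) xs
  All-agree transport ag []       = []
  All-agree transport ag (r ∷ rs) =
    transport (Agree-mono here ag) r ∷ All-agree transport (Agree-mono there ag) rs

  updateT : Interp → ℕ → GTerm → Interp
  updateT ρ Y g = record ρ { tρ = λ Z → if does (Z ≟ Y) then g else tρ ρ Z }

  updateA : Interp → ℕ → Atom → Interp
  updateA ρ C c = record ρ { aρ = λ A → if does (A ≟ C) then c else aρ ρ A }

  updateT-agree : ∀ {O ρ Y g} → ¬ O (tvar Y) → Agree O ρ (updateT ρ Y g)
  updateT-agree {Y = Y} Y∉O = record
    { atoms = λ _ → refl
    ; terms = λ {Z} o → ≡⇒≈E (sym (if-≟-≢ Z Y λ { refl → Y∉O o }))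
    }

  updateA-agree : ∀ {O ρ C c} → ¬ O (avar C) → Agree O ρ (updateA ρ C c)
  updateA-agree {C = C} C∉O = record
    { atoms = λ {A} o → sym (if-≟-≢ A C λ { refl → C∉O o })
    ; terms = λ _ → ≈refl
    }

  updateTs : ∀ {n} → Interp → Vec ℕ n → Vec GTerm n → Interp
  updateTs ρ []       []       = ρ
  updateTs ρ (Y ∷ Ys) (g ∷ gs) = updateT (updateTs ρ Ys gs) Y g

  updateTs-agree : ∀ {O n} ρ (Ys : Vec ℕ n) gs → (∀ i → ¬ O (tvar (Vec.lookup Ys i))) →
                   Agree O ρ (updateTs ρ Ys gs)
  updateTs-agree ρ []       []       _    = Agree-refl
  updateTs-agree ρ (Y ∷ Ys) (g ∷ gs) Ys∉O =
    Agree-trans (updateTs-agree ρ Ys gs (Ys∉O ∘ suc)) (updateT-agree (Ys∉O zero))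

  updateTs-lookup : ∀ {n} ρ (Ys : Vec ℕ n) gs → (∀ i j → Vec.lookup Ys i ≡ Vec.lookup Ys j → i ≡ j) →
                    ∀ i → tρ (updateTs ρ Ys gs) (Vec.lookup Ys i) ≡ Vec.lookup gs i
  updateTs-lookup ρ (Y ∷ Ys) (g ∷ gs) _        zero    = if-≟-≡ Y Y refl
  updateTs-lookup ρ (Y ∷ Ys) (g ∷ gs) distinct (suc i) =
    trans (if-≟-≢ (Vec.lookup Ys i) Y (0≢1+n ∘ sym ∘ distinct (suc i) zero))
          (updateTs-lookup ρ Ys gs (λ i j → suc-injective ∘ distinct (suc i) (suc j)) i)

  ↦t-agree : ∀ {O ρ ρ′ X u} → tρ ρ X ≈E ⟦ u ⟧T ρ′ → Agree O ρ ρ′ → Agree O ρ ([ X ↦t u ] ⊙ ρ′)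
  ↦t-agree {O} {ρ} {ρ′} {X} {u} X≈u ag = record { atoms = atoms ag ; terms = λ {Z} → term Z }
    where
    term : ∀ Z → O (tvar Z) → tρ ρ Z ≈E ⟦ tv [ X ↦t u ] Z ⟧T ρ′
    term Z o with Z ≟ X
    ... | yes refl = ≈trans X≈u (≡⇒≈E (cong (λ w → ⟦ w ⟧T ρ′) (sym (if-≟-≡ Z Z refl))))
    ... | no Z≢X   = ≈trans (terms ag o)
      (≡⇒≈E (sym (trans (cong (λ w → ⟦ w ⟧T ρ′) (if-≟-≢ Z X Z≢X)) (actG-id (tρ ρ′ Z)))))

  ↦a-agree : ∀ {O ρ ρ′ C W} → aρ ρ C ≡ ⟦ W ⟧W ρ′ → Agree O ρ ρ′ → Agree O ρ ([ C ↦a W ] ⊙ ρ′)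
  ↦a-agree {O} {ρ} {ρ′} {C} {W} C≡W ag = record
    { atoms = λ {A} → atom A
    ; terms = λ o → ≈trans (terms ag o) (≡⇒≈E (sym (actG-id _)))
    }
    where
    atom : ∀ A → O (avar A) → aρ ρ A ≡ ⟦ av [ C ↦a W ] A ⟧W ρ′
    atom A o with A ≟ C
    ... | yes refl = trans C≡W (cong (λ W′ → ⟦ W′ ⟧W ρ′) (sym (if-≟-≡ A A refl)))
    ... | no A≢C   = trans (atoms ag o) (cong (λ W′ → ⟦ W′ ⟧W ρ′) (sym (if-≟-≢ A C A≢C)))

  -- Argument lists are evaluated in Maybe GTerm, the f-semigroup of ground terms with a unit
  -- (nothing) adjoined, so that concatenation and permutation need no nonemptiness side conditions.
  module Flattening (f : ESym) where

    _≈ᴹ_ : Maybe GTerm → Maybe GTerm → Set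
    _≈ᴹ_ = Maybeᴾ.Pointwise _≈E_

    ≈ᴹ-refl : ∀ {m} → m ≈ᴹ m
    ≈ᴹ-refl = Maybeᴾ.refl ≈refl

    ≈ᴹ-sym : ∀ {m₁ m₂} → m₁ ≈ᴹ m₂ → m₂ ≈ᴹ m₁
    ≈ᴹ-sym = Maybeᴾ.sym ≈sym

    ≈ᴹ-trans : ∀ {m₁ m₂ m₃} → m₁ ≈ᴹ m₂ → m₂ ≈ᴹ m₃ → m₁ ≈ᴹ m₃
    ≈ᴹ-trans = Maybeᴾ.trans ≈trans

    _⊛_ : Maybe GTerm → Maybe GTerm → Maybe GTerm
    nothing ⊛ m       = m
    just x  ⊛ nothing = just x
    just x  ⊛ just y  = just (geapp f x y)

    ⊛-cong : ∀ {m₁ n₁ m₂ n₂} → m₁ ≈ᴹ n₁ → m₂ ≈ᴹ n₂ → (m₁ ⊛ m₂) ≈ᴹ (n₁ ⊛ n₂)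
    ⊛-cong nothing    m₂≈n₂        = m₂≈n₂
    ⊛-cong (just x≈y) nothing      = just x≈y
    ⊛-cong (just x≈y) (just x′≈y′) = just (≈eapp x≈y x′≈y′)

    ⊛-assoc : IsAssoc theory → ∀ m₁ m₂ m₃ → ((m₁ ⊛ m₂) ⊛ m₃) ≈ᴹ (m₁ ⊛ (m₂ ⊛ m₃))
    ⊛-assoc _     nothing  _        _        = ≈ᴹ-refl
    ⊛-assoc _     (just x) nothing  _        = ≈ᴹ-refl
    ⊛-assoc _     (just x) (just y) nothing  = ≈ᴹ-refl
    ⊛-assoc assoc (just x) (just y) (just z) = just (≈assoc assoc)

    ⊛-comm : IsComm theory → ∀ m₁ m₂ → (m₁ ⊛ m₂) ≈ᴹ (m₂ ⊛ m₁)
    ⊛-comm _    nothing  nothing  = ≈ᴹ-refl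
    ⊛-comm _    nothing  (just y) = ≈ᴹ-refl
    ⊛-comm _    (just x) nothing  = ≈ᴹ-refl
    ⊛-comm comm (just x) (just y) = just (≈comm comm)

    ⟦_⟧L : List Term → Interp → Maybe GTerm
    ⟦ []     ⟧L ρ = nothing
    ⟦ t ∷ ts ⟧L ρ = just (⟦ t ⟧T ρ) ⊛ ⟦ ts ⟧L ρ

    ⟦++⟧L : IsAssoc theory → ∀ ρ ts us → ⟦ ts ++ us ⟧L ρ ≈ᴹ (⟦ ts ⟧L ρ ⊛ ⟦ us ⟧L ρ)
    ⟦++⟧L assoc ρ []       us = ≈ᴹ-refl
    ⟦++⟧L assoc ρ (t ∷ ts) us = ≈ᴹ-trans (⊛-cong ≈ᴹ-refl (⟦++⟧L assoc ρ ts us))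
      (≈ᴹ-sym (⊛-assoc assoc (just (⟦ t ⟧T ρ)) (⟦ ts ⟧L ρ) (⟦ us ⟧L ρ)))

    ⟦⟧L-↭ : IsAssoc theory → IsComm theory → ∀ ρ {ts us} → ts ↭ us → ⟦ ts ⟧L ρ ≈ᴹ ⟦ us ⟧L ρ
    ⟦⟧L-↭ assoc comm ρ ↭-refl        = ≈ᴹ-refl
    ⟦⟧L-↭ assoc comm ρ (↭-prep t p)  = ⊛-cong ≈ᴹ-refl (⟦⟧L-↭ assoc comm ρ p)
    ⟦⟧L-↭ assoc comm ρ (↭-trans p q) = ≈ᴹ-trans (⟦⟧L-↭ assoc comm ρ p) (⟦⟧L-↭ assoc comm ρ q)
    ⟦⟧L-↭ assoc comm ρ (↭-swap {ts} {us} t u p) =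
      ≈ᴹ-trans (≈ᴹ-sym (⊛-assoc assoc ⟦t⟧ ⟦u⟧ (⟦ ts ⟧L ρ)))
      (≈ᴹ-trans (⊛-cong (⊛-comm comm ⟦t⟧ ⟦u⟧) (⟦⟧L-↭ assoc comm ρ p))
                (⊛-assoc assoc ⟦u⟧ ⟦t⟧ (⟦ us ⟧L ρ)))
      where ⟦t⟧ = just (⟦ t ⟧T ρ)
            ⟦u⟧ = just (⟦ u ⟧T ρ)

    ⟦build⟧ : ∀ ρ t ts → just (⟦ build f (t ∷⁺ ts) ⟧T ρ) ≡ ⟦ t ∷ ts ⟧L ρ
    ⟦build⟧ ρ t []       = refl
    ⟦build⟧ ρ t (u ∷ us) = cong (just (⟦ t ⟧T ρ) ⊛_) (⟦build⟧ ρ u us)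

    ⟦⟧L-Flat : IsAssoc theory → ∀ ρ {t ts} → Flat f t ts → just (⟦ t ⟧T ρ) ≈ᴹ ⟦ ts ⟧L ρ
    ⟦⟧L-Flat assoc ρ (fleaf _)                    = ≈ᴹ-refl
    ⟦⟧L-Flat assoc ρ (fnode {as = as} {bs} fa fb) =
      ≈ᴹ-trans (⊛-cong (⟦⟧L-Flat assoc ρ fa) (⟦⟧L-Flat assoc ρ fb)) (≈ᴹ-sym (⟦++⟧L assoc ρ as bs))

    Flat-split : IsAssoc theory → ∀ ρ {t ts} (us₁ us₂ : List⁺ Term) → Flat f t ts →
                 ⟦ ts ⟧L ρ ≈ᴹ ⟦ toList us₁ ++ toList us₂ ⟧L ρ →
                 geapp f (⟦ build f us₁ ⟧T ρ) (⟦ build f us₂ ⟧T ρ) ≈E ⟦ t ⟧T ρ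
    Flat-split assoc ρ (u₁ ∷⁺ us₁) (u₂ ∷⁺ us₂) flat ts≈us = Maybeᴾ.drop-just (≈ᴹ-sym
      (≈ᴹ-trans (⟦⟧L-Flat assoc ρ flat) (≈ᴹ-trans ts≈us
        (≈ᴹ-trans (⟦++⟧L assoc ρ (u₁ ∷ us₁) (u₂ ∷ us₂))
                  (⊛-cong (Maybeᴾ.reflexive ≡⇒≈E (sym (⟦build⟧ ρ u₁ us₁)))
                          (Maybeᴾ.reflexive ≡⇒≈E (sym (⟦build⟧ ρ u₂ us₂))))))))

    Occ-build : ∀ {v} t ts → OccT v (build f (t ∷⁺ ts)) → Any (OccT v) (t ∷ ts)
    Occ-build t []       o            = here o
    Occ-build t (u ∷ us) (occEappl o) = here o
    Occ-build t (u ∷ us) (occEappr o) = there (Occ-build u us o)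

    Occ-Flat : ∀ {v t ts} → Flat f t ts → Any (OccT v) ts → OccT v t
    Occ-Flat (fleaf _)               (here o) = o
    Occ-Flat (fnode {as = as} fa fb) o with Anyₚ.++⁻ as o
    ... | inj₁ o′ = occEappl (Occ-Flat fa o′)
    ... | inj₂ o′ = occEappr (Occ-Flat fb o′)

    Occ-split : ∀ {v t ts} (us₁ us₂ : List⁺ Term) → Flat f t ts → ts ↭ toList us₁ ++ toList us₂ →
                OccT v (build f us₁) ⊎ OccT v (build f us₂) → OccT v t
    Occ-split (u₁ ∷⁺ us₁) (u₂ ∷⁺ us₂) flat ts↭ o = Occ-Flat flat (Any-resp-↭ (↭-sym ts↭)
      ([ Anyₚ.++⁺ˡ , Anyₚ.++⁺ʳ (u₁ ∷ us₁) ] (Sum.map (Occ-build u₁ us₁) (Occ-build u₂ us₂) o)))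

  record Splits (f : ESym) (t t₁ t₂ : Term) : Set where
    field
      ⟦⟧-splits  : ∀ ρ → geapp f (⟦ t₁ ⟧T ρ) (⟦ t₂ ⟧T ρ) ≈E ⟦ t ⟧T ρ
      occ-splits : ∀ {v} → OccT v t₁ ⊎ OccT v t₂ → OccT v t
  open Splits

  Splits-neapp : ∀ {f t₁ t₂} → Splits f (neapp f t₁ t₂) t₁ t₂
  Splits-neapp = record { ⟦⟧-splits = λ _ → ≈refl ; occ-splits = [ occEappl , occEappr ] }

  Splits-neapp-swap : ∀ {f t₁ t₂} → IsComm theory → Splits f (neapp f t₁ t₂) t₂ t₁
  Splits-neapp-swap comm = record
    { ⟦⟧-splits = λ _ → ≈comm comm ; occ-splits = [ occEappr , occEappl ] }

  Splits-FlatA : ∀ {f t ts} us₁ us₂ → IsAssoc theory → Flat f t ts → ts ≡ toList us₁ ++ toList us₂ →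
                 Splits f t (build f us₁) (build f us₂)
  Splits-FlatA {f} us₁ us₂ assoc flat refl = record
    { ⟦⟧-splits  = λ ρ → Flat-split assoc ρ us₁ us₂ flat ≈ᴹ-refl
    ; occ-splits = Occ-split us₁ us₂ flat ↭-refl
    }
    where open Flattening f

  Splits-FlatAC : ∀ {f t ts} {us₁ us₂ : List⁺ Term} → IsAssoc theory → IsComm theory →
                  Flat f t ts → ts ↭ toList us₁ ++ toList us₂ → Splits f t (build f us₁) (build f us₂)
  Splits-FlatAC {f} {us₁ = us₁} {us₂} assoc comm flat ts↭ = record
    { ⟦⟧-splits  = λ ρ → Flat-split assoc ρ us₁ us₂ flat (⟦⟧L-↭ assoc comm ρ ts↭)
    ; occ-splits = Occ-split us₁ us₂ flat ts↭
    }
    where open Flattening f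

  OccT-susp-pid : ∀ {v X} → OccT v (susp pid X) → v ≡ tvar X
  OccT-susp-pid (occSuspX v≡X) = v≡X

  OccT-lookup : ∀ {v n} (us : Vec Term n) i → OccT v (Vec.lookup us i) → VAny.Any (OccT v) us
  OccT-lookup us i o = VAny.map (λ { refl → o }) (∈-lookup i us)

  ¬OccP-tvar : ∀ {X} p → ¬ OccP (tvar X) p
  ¬OccW-tvar : ∀ {X} W → ¬ OccW (tvar X) W
  ¬OccP-tvar (pswap W₁ W₂ p) (occ₁ o) = ¬OccW-tvar W₁ o
  ¬OccP-tvar (pswap W₁ W₂ p) (occ₂ o) = ¬OccW-tvar W₂ o
  ¬OccP-tvar (pswap W₁ W₂ p) (occ₃ o) = ¬OccP-tvar p o
  ¬OccW-tvar (p · A) (occPerm o) = ¬OccP-tvar p o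

  OccT-tvar-·t⁻¹  : ∀ {X} q u → OccT (tvar X) (q ·t u) → OccT (tvar X) u
  OccTs-tvar-·t⁻¹ : ∀ {X n} q (us : Vec Term n) →
                    VAny.Any (OccT (tvar X)) (actTs q us) → VAny.Any (OccT (tvar X)) us
  OccT-tvar-·t⁻¹ q (susp p Y)    (occSuspX X≡Y) = occSuspX X≡Y
  OccT-tvar-·t⁻¹ q (susp p Y)    (occSuspP o)   = ⊥-elim (¬OccP-tvar (q ∘p p) o)
  OccT-tvar-·t⁻¹ q (atm W)       (occAtm o)     = ⊥-elim (¬OccW-tvar (q ·W W) o)
  OccT-tvar-·t⁻¹ q (nfapp f us)  (occFapp o)    = occFapp (OccTs-tvar-·t⁻¹ q us o)
  OccT-tvar-·t⁻¹ q (neapp f u w) (occEappl o)   = occEappl (OccT-tvar-·t⁻¹ q u o)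
  OccT-tvar-·t⁻¹ q (neapp f u w) (occEappr o)   = occEappr (OccT-tvar-·t⁻¹ q w o)
  OccT-tvar-·t⁻¹ q (lam W u)     (occLamW o)    = ⊥-elim (¬OccW-tvar (q ·W W) o)
  OccT-tvar-·t⁻¹ q (lam W u)     (occLamT o)    = occLamT (OccT-tvar-·t⁻¹ q u o)
  OccTs-tvar-·t⁻¹ q (u ∷ us) (VAny.here o)  = VAny.here (OccT-tvar-·t⁻¹ q u o)
  OccTs-tvar-·t⁻¹ q (u ∷ us) (VAny.there o) = VAny.there (OccTs-tvar-·t⁻¹ q us o)

  -- The invariant of a derivation

  data Side : Set where
    left right : Side

  pick : ∀ {A : Set} → Side → A → A → A
  pick left  x y = x
  pick right x y = y

  pick-⊎ : ∀ {A : Set} (Q : A → Set) sd {x y} → Q (pick sd x y) → Q x ⊎ Q y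
  pick-⊎ Q left  q = inj₁ q
  pick-⊎ Q right q = inj₂ q

  pick-⁺ : ∀ {A : Set} (Q : A → Set) sd {x y} → Q x → Q y → Q (pick sd x y)
  pick-⁺ Q left  q _ = q
  pick-⁺ Q right _ q = q

  pick₂ : ∀ {A B : Set} {R : A → B → Set} sd {x₁ y₁ x₂ y₂} →
          R x₁ x₂ → R y₁ y₂ → R (pick sd x₁ y₁) (pick sd x₂ y₂)
  pick₂ left  r _ = r
  pick₂ right _ r = r

  pick-∘ : ∀ {A B : Set} sd (g : A → B) {x y} → g (pick sd x y) ≡ pick sd (g x) (g y)
  pick-∘ left  g = refl
  pick-∘ right g = refl

  pick-∘₂ : ∀ {A B C : Set} sd (g : A → B → C) {x₁ y₁ x₂ y₂} →
            g (pick sd x₁ y₁) (pick sd x₂ y₂) ≡ pick sd (g x₁ x₂) (g y₁ y₂)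
  pick-∘₂ left  g = refl
  pick-∘₂ right g = refl

  pick-≈E : ∀ sd {l r ρ} → ⟦ l ⟧T ρ ≈E ⟦ r ⟧T ρ → ⟦ l ⟧T ρ ≈E ⟦ pick sd l r ⟧T ρ
  pick-≈E left  _   = ≈refl
  pick-≈E right l≈r = l≈r

  pick-Splits : ∀ sd {f l l₁ l₂ r r₁ r₂} → Splits f l l₁ l₂ → Splits f r r₁ r₂ →
                Splits f (pick sd l r) (pick sd l₁ r₁) (pick sd l₂ r₂)
  pick-Splits left  l-splits _ = l-splits
  pick-Splits right _ r-splits = r-splits

  EqHolds : Side → Interp → PEq → Set
  EqHolds sd ρ (Z ∶ l ≜ r) = tρ ρ Z ≈E ⟦ pick sd l r ⟧T ρ

  StoreHolds : Side → Interp → SEq → Set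
  StoreHolds sd ρ (teq Z l r)   = tρ ρ Z ≈E ⟦ pick sd l r ⟧T ρ
  StoreHolds sd ρ (aeq C W₁ W₂) = aρ ρ C ≡ ⟦ pick sd W₁ W₂ ⟧W ρ

  occ-pick : ∀ sd {v Z l r} → OccT v (pick sd l r) → OccPEq v (Z ∶ l ≜ r)
  occ-pick sd {v} = inj₂ ∘ pick-⊎ (OccT v) sd

  EqHolds-agree : ∀ {sd e ρ ρ′} → Agree (λ v → OccPEq v e) ρ ρ′ → EqHolds sd ρ e → EqHolds sd ρ′ e
  EqHolds-agree {sd} {Z ∶ l ≜ r} ag Z≈ = ≈trans (≈sym (terms ag (inj₁ refl)))
    (≈trans Z≈ (⟦⟧T-agree (pick sd l r) (Agree-mono (occ-pick sd) ag)))

  StoreHolds-agree : ∀ {sd e ρ ρ′} → Agree (λ v → OccSEq v e) ρ ρ′ →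
                     StoreHolds sd ρ e → StoreHolds sd ρ′ e
  StoreHolds-agree {sd} {teq Z l r} ag Z≈ = ≈trans (≈sym (terms ag (inj₁ refl)))
    (≈trans Z≈ (⟦⟧T-agree (pick sd l r) (Agree-mono (occ-pick sd) ag)))
  StoreHolds-agree {sd} {aeq C W₁ W₂} ag C≡ = trans (sym (atoms ag (inj₁ refl)))
    (trans C≡ (⟦⟧W-agree (pick sd W₁ W₂) (Agree-mono (λ {v} → inj₂ ∘ pick-⊎ (OccW v) sd) ag)))

  EqHolds-fresh : ∀ {sd Y l r ρ ρ′} → tρ ρ′ Y ≡ ⟦ pick sd l r ⟧T ρ →
                  Agree (λ v → OccT v (pick sd l r)) ρ ρ′ → EqHolds sd ρ′ (Y ∶ l ≜ r)
  EqHolds-fresh {sd} {l = l} {r} Y↦ ag = ≈trans (≡⇒≈E Y↦) (⟦⟧T-agree (pick sd l r) ag)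

  record Witness (sd : Side) (G : GTerm) (X : ℕ) (st : State) (ρ : Interp) : Set where
    constructor witness
    field
      context : Holds (State.Γ st) ρ
      root    : ⟦ tv (State.σ st) X ⟧T ρ ≈E G
      problem : All (EqHolds sd ρ) (State.P st)
      store   : All (StoreHolds sd ρ) (State.S st)
  open Witness

  with-problems : ∀ {sd G X P S Γ σ ρ news} → All (EqHolds sd ρ) news →
    Witness sd G X ⟨ P , S , Γ , σ ⟩ ρ → Witness sd G X ⟨ news ++ P , S , Γ , σ ⟩ ρ
  with-problems news (witness Γ-holds root P-holds S-holds) =
    witness Γ-holds root (Allₚ.++⁺ news P-holds) S-holds

  with-store : ∀ {sd G X P S Γ σ ρ e} → StoreHolds sd ρ e →
    Witness sd G X ⟨ P , S , Γ , σ ⟩ ρ → Witness sd G X ⟨ P , e ∷ S , Γ , σ ⟩ ρ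
  with-store e (witness Γ-holds root P-holds S-holds) = witness Γ-holds root P-holds (e ∷ S-holds)

  with-constraints : ∀ {sd G X P S Γ Γ′ σ ρ} → Holds Γ′ ρ →
    Witness sd G X ⟨ P , S , Γ , σ ⟩ ρ → Witness sd G X ⟨ P , S , Γ ++ Γ′ , σ ⟩ ρ
  with-constraints Γ′ (witness Γ-holds root P-holds S-holds) =
    witness (Allₚ.++⁺ Γ-holds Γ′) root P-holds S-holds

  Visible : ℕ → State → Var → Set
  Visible X st v = OccState v st ⊎ OccT v (tv (State.σ st) X)

  Agree-processed : ∀ {X P P′ S Γ σ X′ l r ρ ρ′} → P ↭ (X′ ∶ l ≜ r) ∷ P′ →
    Agree (Visible X ⟨ P , S , Γ , σ ⟩) ρ ρ′ → Agree (λ v → OccPEq v (X′ ∶ l ≜ r)) ρ ρ′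
  Agree-processed P↭ = Agree-mono (inj₁ ∘ inj₁ ∘ Any-resp-↭ (↭-sym P↭) ∘ here)

  Witness-resolve : ∀ {sd G X P P′ S Γ σ X′ l r ρ ρ′} u →
    Witness sd G X ⟨ P , S , Γ , σ ⟩ ρ → P ↭ (X′ ∶ l ≜ r) ∷ P′ →
    Agree (Visible X ⟨ P , S , Γ , σ ⟩) ρ ρ′ → ⟦ u ⟧T ρ′ ≈E ⟦ pick sd l r ⟧T ρ →
    Witness sd G X ⟨ P′ , S , Γ , σ ⨾ [ X′ ↦t u ] ⟩ ρ′
  Witness-resolve {X = X} {σ = σ} {X′} {ρ′ = ρ′} u w P↭ ag u≈ = witness
    (All-agree (λ {c} → HoldsFC-agree c) (Agree-mono (inj₁ ∘ inj₂ ∘ inj₂ ∘ inj₁) ag) (context w))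
    (≈trans (≡⇒≈E (⟦substT⟧ (tv σ X) [ X′ ↦t u ] ρ′))
            (≈trans (≈sym (⟦⟧T-agree (tv σ X) (↦t-agree X′≈u (Agree-mono inj₂ ag)))) (root w)))
    (All-agree EqHolds-agree (Agree-mono (inj₁ ∘ inj₁ ∘ Any-resp-↭ (↭-sym P↭) ∘ there) ag)
               (All.tail holds))
    (All-agree StoreHolds-agree (Agree-mono (inj₁ ∘ inj₂ ∘ inj₁) ag) (store w))
    where
    holds = All-resp-↭ P↭ (problem w)
    X′≈u  = ≈trans (All.head holds) (≈sym u≈)

  Avoids : ℕ → PEq → Set
  Avoids X (_ ∶ l ≜ r) = ¬ OccT (tvar X) l × ¬ OccT (tvar X) r

  -- While equations remain, either Xσ is still the variable X, which then labels the only
  -- equation, or X is in the domain of σ; either way no fresh variable occurs in Xσ.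
  data RootInv (X : ℕ) : List PEq → Subst → Set where
    solved  : ∀ {σ} → RootInv X [] σ
    pending : ∀ {P σ} → All (Avoids X) P →
              (tv σ X ≡ susp pid X → ∃₂ λ l r → P ≡ (X ∶ l ≜ r) ∷ []) → RootInv X P σ

  ↭-singleton-∷⁻¹ : ∀ {A : Set} {xs : List A} {x y ys} → xs ↭ y ∷ ys → xs ≡ x ∷ [] → y ≡ x × ys ≡ []
  ↭-singleton-∷⁻¹ xs↭ refl with ↭-singleton-inv (↭-sym xs↭)
  ... | refl = refl , refl

  fresh-invisible : ∀ {X P S Γ σ e P′ v} → RootInv X P σ → P ↭ e ∷ P′ →
                    Fresh v ⟨ P , S , Γ , σ ⟩ → ¬ Visible X ⟨ P , S , Γ , σ ⟩ v
  fresh-invisible solved P↭ = ⊥-elim (¬x∷xs↭[] (↭-sym P↭))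
  fresh-invisible {X} {σ = σ} {v = v} (pending _ var⇒single) _ fresh = [ fresh , not-in-root ]
    where
    not-in-root : ¬ OccT v (tv σ X)
    not-in-root v∈Xσ = fresh (inj₂ (inj₂ (inj₂ (inj₁ (X , X-bound , inj₂ v∈Xσ)))))
      where
      X-bound : tv σ X ≢ susp pid X
      X-bound Xσ≡X with var⇒single Xσ≡X | OccT-susp-pid (subst (OccT v) Xσ≡X v∈Xσ)
      ... | _ , _ , refl | refl = fresh (inj₁ (here (inj₁ refl)))

  ·t-susp⁻¹ : ∀ q u {r X} → q ·t u ≡ susp r X → ∃ λ q′ → u ≡ susp q′ X × q ∘p q′ ≡ r
  ·t-susp⁻¹ q (susp q′ Y) refl = q′ , refl , refl

  ↦t-var⁻¹ : ∀ {X X′ u} w → (∀ q → u ≢ susp q X) →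
             substT w [ X′ ↦t u ] ≡ susp pid X → w ≡ susp pid X × X′ ≢ X
  ↦t-var⁻¹ {X} {X′} {u} (susp pid Z) u-nonvar eq with ·t-susp⁻¹ pid (tv [ X′ ↦t u ] Z) eq
  ... | _ , θZ≡X , refl with Z ≟ X′
  ...   | yes refl = ⊥-elim (u-nonvar pid (trans (sym (if-≟-≡ Z Z refl)) θZ≡X))
  ...   | no Z≢X′ with trans (sym (if-≟-≢ Z X′ Z≢X′)) θZ≡X
  ...     | refl = refl , λ { refl → Z≢X′ refl }
  ↦t-var⁻¹ (susp (pswap _ _ _) Z) _ eq with ·t-susp⁻¹ _ _ eq
  ... | _ , _ , ()
  ↦t-var⁻¹ (atm _)       _ ()
  ↦t-var⁻¹ (nfapp _ _)   _ ()
  ↦t-var⁻¹ (neapp _ _ _) _ ()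
  ↦t-var⁻¹ (lam _ _)     _ ()

  RootInv-resolve : ∀ {X P P′ σ X′ l r} u news → RootInv X P σ → P ↭ (X′ ∶ l ≜ r) ∷ P′ →
    (Avoids X (X′ ∶ l ≜ r) → (∀ q → u ≢ susp q X) × All (Avoids X) news) →
    RootInv X (news ++ P′) (σ ⨾ [ X′ ↦t u ])
  RootInv-resolve u news solved P↭ _ = ⊥-elim (¬x∷xs↭[] (↭-sym P↭))
  RootInv-resolve {X} {σ = σ} {X′} u news (pending avoid var⇒single) P↭ new-avoid =
    pending (Allₚ.++⁺ (proj₂ new) (All.tail avoid′)) (⊥-elim ∘ not-var)
    where
    avoid′ = All-resp-↭ P↭ avoid
    new    = new-avoid (All.head avoid′)
    not-var : substT (tv σ X) [ X′ ↦t u ] ≢ susp pid X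
    not-var eq with ↦t-var⁻¹ (tv σ X) (proj₁ new) eq
    ... | Xσ≡X , X′≢X with var⇒single Xσ≡X
    ... | _ , _ , P≡ with ↭-singleton-∷⁻¹ P↭ P≡
    ... | refl , _ = X′≢X refl

  RootInv-drop : ∀ {X P P′ σ e} → RootInv X P σ → P ↭ e ∷ P′ → RootInv X P′ σ
  RootInv-drop {P′ = []}    _      _   = solved
  RootInv-drop {P′ = _ ∷ _} solved P↭ = ⊥-elim (¬x∷xs↭[] (↭-sym P↭))
  RootInv-drop {P′ = _ ∷ _} (pending avoid var⇒single) P↭ =
    pending (All.tail (All-resp-↭ P↭ avoid))
            (λ Xσ≡X → case ↭-singleton-∷⁻¹ P↭ (proj₂ (proj₂ (var⇒single Xσ≡X))) of λ { (_ , ()) })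

  Invariant : Side → GTerm → ℕ → State → Set
  Invariant sd G X st = RootInv X (State.P st) (State.σ st) × ∃ (Witness sd G X st)

  Witness-suspend : ∀ {sd G X P P′ S Γ σ X′ r ρ} u → Witness sd G X ⟨ P , S , Γ , σ ⟩ ρ →
    P ↭ (X′ ∶ u ≜ r) ∷ P′ → (Holds Γ ρ → ⟦ u ⟧T ρ ≈E ⟦ r ⟧T ρ) →
    Witness sd G X ⟨ P′ , S , Γ , σ ⨾ [ X′ ↦t u ] ⟩ ρ
  Witness-suspend {sd} u w P↭ u≈r = Witness-resolve u w P↭ Agree-refl (pick-≈E sd (u≈r (context w)))

  Witness-sol : ∀ {sd G X P P′ S Γ σ X′ t s ρ} → Witness sd G X ⟨ P , S , Γ , σ ⟩ ρ →
    P ↭ (X′ ∶ t ≜ s) ∷ P′ → Witness sd G X ⟨ P′ , teq X′ t s ∷ S , Γ , σ ⟩ ρ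
  Witness-sol (witness Γ-holds root P-holds S-holds) P↭ =
    witness Γ-holds root (All.tail moved) (All.head moved ∷ S-holds)
    where moved = All-resp-↭ P↭ P-holds

  decEqs-All : ∀ {Q : PEq → Set} {n} (Ys : Vec ℕ n) ts ss →
    (∀ i → Q (Vec.lookup Ys i ∶ Vec.lookup ts i ≜ Vec.lookup ss i)) → All Q (decEqs Ys ts ss)
  decEqs-All []       []       []       _    = []
  decEqs-All (Y ∷ Ys) (t ∷ ts) (s ∷ ss) Q-at = Q-at zero ∷ decEqs-All Ys ts ss (Q-at ∘ suc)

  Witness-dec : ∀ {sd G X P P′ S Γ σ X′ f ts ss ρ} (Ys : Vec ℕ (farity f)) →
    RootInv X P σ → Witness sd G X ⟨ P , S , Γ , σ ⟩ ρ →
    P ↭ (X′ ∶ nfapp f ts ≜ nfapp f ss) ∷ P′ →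
    (∀ i → Fresh (tvar (Vec.lookup Ys i)) ⟨ P , S , Γ , σ ⟩) →
    (∀ i j → Vec.lookup Ys i ≡ Vec.lookup Ys j → i ≡ j) →
    ∃ (Witness sd G X ⟨ decEqs Ys ts ss ++ P′ , S , Γ
                      , σ ⨾ [ X′ ↦t nfapp f (Vec.map (susp pid) Ys) ] ⟩)
  Witness-dec {sd} {f = f} {ts} {ss} {ρ} Ys inv w P↭ fresh distinct =
    ρ′ , with-problems (decEqs-All Ys ts ss new) (Witness-resolve _ w P↭ ag u≈)
    where
    gs = ⟦ pick sd ts ss ⟧Ts ρ
    ρ′ = updateTs ρ Ys gs
    ag = updateTs-agree ρ Ys gs (fresh-invisible inv P↭ ∘ fresh)
    Ys↦ : ∀ i → tρ ρ′ (Vec.lookup Ys i) ≡ Vec.lookup gs i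
    Ys↦ = updateTs-lookup ρ Ys gs distinct
    args≈ : ∀ i → Vec.lookup (⟦ Vec.map (susp pid) Ys ⟧Ts ρ′) i ≈E Vec.lookup gs i
    args≈ i = ≡⇒≈E (begin
      Vec.lookup (⟦ Vec.map (susp pid) Ys ⟧Ts ρ′) i ≡⟨ ⟦⟧Ts-lookup (Vec.map (susp pid) Ys) i ρ′ ⟩
      ⟦ Vec.lookup (Vec.map (susp pid) Ys) i ⟧T ρ′ ≡⟨ cong (λ u → ⟦ u ⟧T ρ′) (Vecₚ.lookup-map i _ Ys) ⟩
      actG [] (tρ ρ′ (Vec.lookup Ys i))             ≡⟨ actG-id _ ⟩
      tρ ρ′ (Vec.lookup Ys i)                       ≡⟨ Ys↦ i ⟩
      Vec.lookup gs i                               ∎)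
    u≈ = ≈trans (≈fapp (Pointwiseᴱ.extensional⇒inductive (Pointwiseᴱ.ext args≈)))
                (≡⇒≈E (cong (λ u → ⟦ u ⟧T ρ) (pick-∘ sd (nfapp f))))
    new : ∀ i → EqHolds sd ρ′ (Vec.lookup Ys i ∶ Vec.lookup ts i ≜ Vec.lookup ss i)
    new i = EqHolds-fresh {sd} {Vec.lookup Ys i} {Vec.lookup ts i} {Vec.lookup ss i}
      (trans (Ys↦ i) (trans (⟦⟧Ts-lookup (pick sd ts ss) i ρ)
                            (cong (λ u → ⟦ u ⟧T ρ) (pick-∘ sd (λ us → Vec.lookup us i)))))
      (Agree-mono (λ {v} → inj₂ ∘ Sum.map (occFapp ∘ OccT-lookup ts i) (occFapp ∘ OccT-lookup ss i)
                                        ∘ pick-⊎ (OccT v) sd)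
                  (Agree-processed P↭ ag))

  Witness-abs : ∀ {sd G X P P′ S Γ σ X′ W₁ W₂ t s ρ} Y C →
    RootInv X P σ → Witness sd G X ⟨ P , S , Γ , σ ⟩ ρ →
    P ↭ (X′ ∶ lam W₁ t ≜ lam W₂ s) ∷ P′ →
    Fresh (tvar Y) ⟨ P , S , Γ , σ ⟩ → Fresh (avar C) ⟨ P , S , Γ , σ ⟩ →
    ∃ (Witness sd G X ⟨ (Y ∶ (swp W₁ C ·t t) ≜ (swp W₂ C ·t s)) ∷ P′ , S
                      , Γ ++ ((pid · C , lam W₁ t) ∷ (pid · C , lam W₂ s) ∷ [])
                      , σ ⨾ [ X′ ↦t lam (pid · C) (susp pid Y) ] ⟩)
  Witness-abs {sd} {W₁ = W₁} {W₂} {t} {s} {ρ} Y C inv w P↭ freshY freshC =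
    ρ′ , with-constraints (C#₁ ∷ C#₂ ∷ []) (with-problems (new ∷ []) (Witness-resolve _ w P↭ ag u≈))
    where
    L₁ = ⟦ lam W₁ t ⟧T ρ
    L₂ = ⟦ lam W₂ s ⟧T ρ
    c  = suc (maxAtom L₁ ⊔ maxAtom L₂)
    c#L₁ : c #g L₁
    c#L₁ = maxAtom<⇒#g L₁ (s≤s (m≤m⊔n _ (maxAtom L₂)))
    c#L₂ : c #g L₂
    c#L₂ = maxAtom<⇒#g L₂ (s≤s (m≤n⊔m (maxAtom L₁) _))
    W = pick sd W₁ W₂
    T = pick sd t s
    g = actG ((⟦ W ⟧W ρ , c) ∷ []) (⟦ T ⟧T ρ)
    ρ′ = updateT (updateA ρ C c) Y g
    ag = Agree-trans (updateA-agree (fresh-invisible inv P↭ freshC))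
                     (updateT-agree (fresh-invisible inv P↭ freshY))
    ag-eq = Agree-processed P↭ ag
    C↦ : aρ ρ′ C ≡ c
    C↦ = if-≟-≡ C C refl
    Y↦ : tρ ρ′ Y ≡ g
    Y↦ = if-≟-≡ Y Y refl
    W-agree : ⟦ W ⟧W ρ ≡ ⟦ W ⟧W ρ′
    W-agree = ⟦⟧W-agree W
      (Agree-mono (λ {v} → inj₂ ∘ Sum.map occLamW occLamW ∘ pick-⊎ (OccW v) sd) ag-eq)
    T-agree : ⟦ T ⟧T ρ ≈E ⟦ T ⟧T ρ′
    T-agree = ⟦⟧T-agree T
      (Agree-mono (λ {v} → inj₂ ∘ Sum.map occLamT occLamT ∘ pick-⊎ (OccT v) sd) ag-eq)
    ⟦lam⟧ : ⟦ lam W T ⟧T ρ ≡ ⟦ pick sd (lam W₁ t) (lam W₂ s) ⟧T ρ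
    ⟦lam⟧ = cong (λ u → ⟦ u ⟧T ρ) (pick-∘₂ sd lam)
    c#WT : c #g glam (⟦ W ⟧W ρ) (⟦ T ⟧T ρ)
    c#WT = subst (c #g_) (sym ⟦lam⟧) (pick-⁺ (λ u → c #g ⟦ u ⟧T ρ) sd c#L₁ c#L₂)
    u≈ : glam (aρ ρ′ C) (actG [] (tρ ρ′ Y)) ≈E ⟦ pick sd (lam W₁ t) (lam W₂ s) ⟧T ρ
    u≈ = ≈trans (≡⇒≈E (cong₂ glam C↦ (trans (actG-id _) Y↦)))
                (≈trans (glam-α (⟦ T ⟧T ρ) c#WT) (≡⇒≈E ⟦lam⟧))
    new : EqHolds sd ρ′ (Y ∶ (swp W₁ C ·t t) ≜ (swp W₂ C ·t s))
    new = ≈trans (≡⇒≈E Y↦) (≈trans (≈E-actG _ T-agree) (≡⇒≈E (begin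
      actG ((⟦ W ⟧W ρ , c) ∷ []) (⟦ T ⟧T ρ′)
        ≡⟨ cong₂ (λ a b → actG ((a , b) ∷ []) (⟦ T ⟧T ρ′)) W-agree (sym C↦) ⟩
      actG (⟦ swp W C ⟧P ρ′) (⟦ T ⟧T ρ′)
        ≡⟨ ⟦·t⟧ (swp W C) T ρ′ ⟨
      ⟦ swp W C ·t T ⟧T ρ′
        ≡⟨ cong (λ u → ⟦ u ⟧T ρ′) (pick-∘₂ sd (λ W′ t′ → swp W′ C ·t t′)) ⟩
      ⟦ pick sd (swp W₁ C ·t t) (swp W₂ C ·t s) ⟧T ρ′ ∎)))
    C#₁ = HoldsFC-fresh (lam W₁ t) C↦ (Agree-mono (inj₂ ∘ inj₁) ag-eq) c#L₁
    C#₂ = HoldsFC-fresh (lam W₂ s) C↦ (Agree-mono (inj₂ ∘ inj₂) ag-eq) c#L₂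

  Witness-solAB : ∀ {sd G X P P′ S Γ σ X′ W₁ W₂ ρ} C →
    RootInv X P σ → Witness sd G X ⟨ P , S , Γ , σ ⟩ ρ →
    P ↭ (X′ ∶ atm W₁ ≜ atm W₂) ∷ P′ → Fresh (avar C) ⟨ P , S , Γ , σ ⟩ →
    ∃ (Witness sd G X ⟨ P′ , aeq C W₁ W₂ ∷ S , Γ ++ ((pid · C , lam W₁ (lam W₂ (atm (pid · C)))) ∷ [])
                      , σ ⨾ [ X′ ↦t atm (pid · C) ] ⟩)
  Witness-solAB {sd} {W₁ = W₁} {W₂} {ρ} C inv w P↭ fresh =
    ρ′ , with-constraints (C# ∷ []) (with-store C≡ (Witness-resolve _ w P↭ ag u≈))
    where
    ρ′ = updateA ρ C (⟦ pick sd W₁ W₂ ⟧W ρ)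
    ag = updateA-agree (fresh-invisible inv P↭ fresh)
    C↦ : aρ ρ′ C ≡ ⟦ pick sd W₁ W₂ ⟧W ρ
    C↦ = if-≟-≡ C C refl
    u≈ : gatom (aρ ρ′ C) ≈E ⟦ pick sd (atm W₁) (atm W₂) ⟧T ρ
    u≈ = ≡⇒≈E (trans (cong gatom C↦) (cong (λ u → ⟦ u ⟧T ρ) (pick-∘ sd atm)))
    C≡ : aρ ρ′ C ≡ ⟦ pick sd W₁ W₂ ⟧W ρ′
    C≡ = trans C↦ (⟦⟧W-agree (pick sd W₁ W₂)
      (Agree-mono (λ {v} → inj₂ ∘ Sum.map occAtm occAtm ∘ pick-⊎ (OccW v) sd) (Agree-processed P↭ ag)))
    C# : HoldsFC (pid · C , lam W₁ (lam W₂ (atm (pid · C)))) ρ′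
    C# = #g-bound (pick-⊎ (λ W → aρ ρ′ C ≡ ⟦ W ⟧W ρ′) sd C≡)

  Witness-split : ∀ {sd G X P P′ S Γ σ X′ l r ρ f l₁ l₂ r₁ r₂ Y₁ Y₂} →
    RootInv X P σ → Witness sd G X ⟨ P , S , Γ , σ ⟩ ρ → P ↭ (X′ ∶ l ≜ r) ∷ P′ →
    Fresh (tvar Y₁) ⟨ P , S , Γ , σ ⟩ → Fresh (tvar Y₂) ⟨ P , S , Γ , σ ⟩ → Y₁ ≢ Y₂ →
    Splits f l l₁ l₂ → Splits f r r₁ r₂ →
    ∃ (Witness sd G X ⟨ (Y₁ ∶ l₁ ≜ r₁) ∷ (Y₂ ∶ l₂ ≜ r₂) ∷ P′ , S , Γ
                      , σ ⨾ [ X′ ↦t neapp f (susp pid Y₁) (susp pid Y₂) ] ⟩)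
  Witness-split {sd} {l = l} {r} {ρ} {f} {l₁} {l₂} {r₁} {r₂} {Y₁} {Y₂}
                inv w P↭ fresh₁ fresh₂ Y₁≢Y₂ l-splits r-splits =
    ρ′ , with-problems (new₁ ∷ new₂ ∷ []) (Witness-resolve _ w P↭ ag u≈)
    where
    splits = pick-Splits sd l-splits r-splits
    ρ′ = updateT (updateT ρ Y₁ (⟦ pick sd l₁ r₁ ⟧T ρ)) Y₂ (⟦ pick sd l₂ r₂ ⟧T ρ)
    ag = Agree-trans (updateT-agree (fresh-invisible inv P↭ fresh₁))
                     (updateT-agree (fresh-invisible inv P↭ fresh₂))
    Y₁↦ : tρ ρ′ Y₁ ≡ ⟦ pick sd l₁ r₁ ⟧T ρ
    Y₁↦ = trans (if-≟-≢ Y₁ Y₂ Y₁≢Y₂) (if-≟-≡ Y₁ Y₁ refl)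
    Y₂↦ : tρ ρ′ Y₂ ≡ ⟦ pick sd l₂ r₂ ⟧T ρ
    Y₂↦ = if-≟-≡ Y₂ Y₂ refl
    ag-side : Agree (λ v → OccT v (pick sd l r)) ρ ρ′
    ag-side = Agree-mono (occ-pick sd) (Agree-processed P↭ ag)
    u≈ : geapp f (actG [] (tρ ρ′ Y₁)) (actG [] (tρ ρ′ Y₂)) ≈E ⟦ pick sd l r ⟧T ρ
    u≈ = ≈trans (≡⇒≈E (cong₂ (geapp f) (trans (actG-id _) Y₁↦) (trans (actG-id _) Y₂↦)))
                (⟦⟧-splits splits ρ)
    new₁ : EqHolds sd ρ′ (Y₁ ∶ l₁ ≜ r₁)
    new₁ = EqHolds-fresh {sd} {Y₁} {l₁} {r₁} Y₁↦ (Agree-mono (occ-splits splits ∘ inj₁) ag-side)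
    new₂ : EqHolds sd ρ′ (Y₂ ∶ l₂ ≜ r₂)
    new₂ = EqHolds-fresh {sd} {Y₂} {l₂} {r₂} Y₂↦ (Agree-mono (occ-splits splits ∘ inj₂) ag-side)

  Witness-merge : ∀ {sd G X S S′ Γ σ ρ} θ → Witness sd G X ⟨ [] , S , Γ , σ ⟩ ρ →
    Agree (λ _ → ⊤) ρ (θ ⊙ ρ) → All (StoreHolds sd ρ) S′ →
    Witness sd G X ⟨ [] , S′ , substCtx Γ θ , σ ⨾ θ ⟩ ρ
  Witness-merge {X = X} {Γ = Γ} {σ} {ρ} θ w ag S′-holds = witness
    (Holds-substCtx Γ θ ρ (All-agree (λ {c} → HoldsFC-agree c) (Agree-mono _ ag) (context w)))
    (≈trans (≡⇒≈E (⟦substT⟧ (tv σ X) θ ρ))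
            (≈trans (≈sym (⟦⟧T-agree (tv σ X) (Agree-mono _ ag))) (root w)))
    []
    S′-holds

  Witness-merT : ∀ {sd G X S S′ Γ σ ρ Z₁ Z₂ t₁ s₁ t₂ s₂} π → Witness sd G X ⟨ [] , S , Γ , σ ⟩ ρ →
    S ↭ teq Z₁ t₁ s₁ ∷ teq Z₂ t₂ s₂ ∷ S′ → Γ ⊨ (π ·t t₁) ≈ t₂ → Γ ⊨ (π ·t s₁) ≈ s₂ →
    Witness sd G X ⟨ [] , teq Z₁ t₁ s₁ ∷ S′ , substCtx Γ [ Z₂ ↦t susp π Z₁ ]
                   , σ ⨾ [ Z₂ ↦t susp π Z₁ ] ⟩ ρ
  Witness-merT {sd} {Γ = Γ} {ρ = ρ} {Z₁} {Z₂} {t₁} {s₁} π w S↭ πt₁≈t₂ πs₁≈s₂ =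
    Witness-merge _ w (↦t-agree Z₂≈ Agree-refl) (Z₁-holds ∷ All.tail (All.tail holds))
    where
    holds    = All-resp-↭ S↭ (store w)
    Z₁-holds = All.head holds
    Z₂≈ : tρ ρ Z₂ ≈E ⟦ susp π Z₁ ⟧T ρ
    Z₂≈ = ≈trans (All.head (All.tail holds)) (≈sym (≈trans (≈E-actG (⟦ π ⟧P ρ) Z₁-holds)
      (≈trans (≡⇒≈E (sym (⟦·t⟧ π (pick sd t₁ s₁) ρ)))
              (pick₂ {R = λ u u′ → Γ ⊨ (π ·t u) ≈ u′} sd πt₁≈t₂ πs₁≈s₂ ρ (context w)))))

  Witness-merA : ∀ {sd G X S S′ Γ σ ρ Z₁ Z₂ W₁ V₁ W₂ V₂} π → Witness sd G X ⟨ [] , S , Γ , σ ⟩ ρ →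
    S ↭ aeq Z₁ W₁ V₁ ∷ aeq Z₂ W₂ V₂ ∷ S′ → Γ ⊨ (π ·W W₁) =a W₂ → Γ ⊨ (π ·W V₁) =a V₂ →
    Witness sd G X ⟨ [] , aeq Z₁ W₁ V₁ ∷ S′ , substCtx Γ [ Z₂ ↦a π · Z₁ ]
                   , σ ⨾ [ Z₂ ↦a π · Z₁ ] ⟩ ρ
  Witness-merA {sd} {Γ = Γ} {ρ = ρ} {Z₁} {Z₂} {W₁} {V₁} π w S↭ πW₁=W₂ πV₁=V₂ =
    Witness-merge _ w (↦a-agree Z₂≡ Agree-refl) (Z₁-holds ∷ All.tail (All.tail holds))
    where
    holds    = All-resp-↭ S↭ (store w)
    Z₁-holds = All.head holds
    Z₂≡ : aρ ρ Z₂ ≡ ⟦ π · Z₁ ⟧W ρ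
    Z₂≡ = trans (All.head (All.tail holds)) (sym (trans (cong (actA (⟦ π ⟧P ρ)) Z₁-holds)
      (trans (sym (⟦·W⟧ π (pick sd W₁ V₁) ρ))
             (pick₂ {R = λ W W′ → Γ ⊨ (π ·W W) =a W′} sd πW₁=W₂ πV₁=V₂ ρ (context w)))))

  Splits-avoid : ∀ {X f l l₁ l₂ r r₁ r₂ Y₁ Y₂} → Splits f l l₁ l₂ → Splits f r r₁ r₂ →
    ¬ OccT (tvar X) l × ¬ OccT (tvar X) r → All (Avoids X) ((Y₁ ∶ l₁ ≜ r₁) ∷ (Y₂ ∶ l₂ ≜ r₂) ∷ [])
  Splits-avoid l-splits r-splits (X∉l , X∉r) =
    (X∉l ∘ occ-splits l-splits ∘ inj₁ , X∉r ∘ occ-splits r-splits ∘ inj₁) ∷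
    (X∉l ∘ occ-splits l-splits ∘ inj₂ , X∉r ∘ occ-splits r-splits ∘ inj₂) ∷ []

  Invariant-split : ∀ {sd G X P P′ S Γ σ X′ l r f l₁ l₂ r₁ r₂ Y₁ Y₂} →
    P ↭ (X′ ∶ l ≜ r) ∷ P′ → Fresh (tvar Y₁) ⟨ P , S , Γ , σ ⟩ → Fresh (tvar Y₂) ⟨ P , S , Γ , σ ⟩ →
    Y₁ ≢ Y₂ → Splits f l l₁ l₂ → Splits f r r₁ r₂ → Invariant sd G X ⟨ P , S , Γ , σ ⟩ →
    Invariant sd G X ⟨ (Y₁ ∶ l₁ ≜ r₁) ∷ (Y₂ ∶ l₂ ≜ r₂) ∷ P′ , S , Γ
                     , σ ⨾ [ X′ ↦t neapp f (susp pid Y₁) (susp pid Y₂) ] ⟩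
  Invariant-split {f = f} {l₁} {l₂} {r₁} {r₂} {Y₁} {Y₂}
                  P↭ fresh₁ fresh₂ Y₁≢Y₂ l-splits r-splits (inv , _ , w) =
    RootInv-resolve (neapp f (susp pid Y₁) (susp pid Y₂)) ((Y₁ ∶ l₁ ≜ r₁) ∷ (Y₂ ∶ l₂ ≜ r₂) ∷ []) inv P↭
      (λ avoid → (λ _ ()) , Splits-avoid l-splits r-splits avoid) ,
    Witness-split inv w P↭ fresh₁ fresh₂ Y₁≢Y₂ l-splits r-splits

  Invariant-step : ∀ {sd G X st st′} → st ⇒ st′ → Invariant sd G X st → Invariant sd G X st′
  Invariant-step (Dec {f = f} {ts} {ss} Ys P↭ fresh distinct) (inv , _ , w) =
    RootInv-resolve (nfapp f (Vec.map (susp pid) Ys)) (decEqs Ys ts ss) inv P↭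
      (λ (X∉ts , X∉ss) → (λ _ ()) , decEqs-All Ys ts ss λ i →
        X∉ts ∘ occFapp ∘ OccT-lookup ts i , X∉ss ∘ occFapp ∘ OccT-lookup ss i) ,
    Witness-dec Ys inv w P↭ fresh distinct
  Invariant-step (Abs {W₁ = W₁} {W₂} {t} {s} Y C P↭ freshY freshC) (inv , _ , w) =
    RootInv-resolve (lam (pid · C) (susp pid Y)) ((Y ∶ (swp W₁ C ·t t) ≜ (swp W₂ C ·t s)) ∷ []) inv P↭
      (λ (X∉l , X∉r) → (λ _ ()) ,
        (X∉l ∘ occLamT ∘ OccT-tvar-·t⁻¹ (swp W₁ C) t ,
         X∉r ∘ occLamT ∘ OccT-tvar-·t⁻¹ (swp W₂ C) s) ∷ []) ,
    Witness-abs Y C inv w P↭ freshY freshC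
  Invariant-step (SusAA {W₁ = W₁} P↭ W₁=W₂) (inv , _ , w) =
    RootInv-resolve (atm W₁) [] inv P↭ (λ _ → (λ _ ()) , []) ,
    -, Witness-suspend _ w P↭ (λ Γ-holds → ≡⇒≈E (cong gatom (W₁=W₂ _ Γ-holds)))
  Invariant-step (SusYY {p₁ = p₁} {Y = Y} P↭ π₁Y≈π₂Y) (inv , _ , w) =
    RootInv-resolve (susp p₁ Y) [] inv P↭ (λ (X∉l , _) → (λ { _ refl → X∉l (occSuspX refl) }) , []) ,
    -, Witness-suspend _ w P↭ (π₁Y≈π₂Y _)
  Invariant-step (SolAB C P↭ _ fresh) (inv , _ , w) =
    RootInv-resolve (atm (pid · C)) [] inv P↭ (λ _ → (λ _ ()) , []) ,
    Witness-solAB C inv w P↭ fresh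
  Invariant-step (Sol P↭ _) (inv , _ , w) = RootInv-drop inv P↭ , -, Witness-sol w P↭
  Invariant-step (MerT π S↭ πt₁≈t₂ πs₁≈s₂) (_ , _ , w) = solved , -, Witness-merT π w S↭ πt₁≈t₂ πs₁≈s₂
  Invariant-step (MerA π S↭ πW₁=W₂ πV₁=V₂) (_ , _ , w) = solved , -, Witness-merA π w S↭ πW₁=W₂ πV₁=V₂
  Invariant-step (DecA us₁ us₂ vs₁ vs₂ _ _ isA P↭ flat-t t≡ flat-s s≡ fresh₁ fresh₂ Y₁≢Y₂) =
    Invariant-split P↭ fresh₁ fresh₂ Y₁≢Y₂
      (Splits-FlatA us₁ us₂ assoc flat-t t≡) (Splits-FlatA vs₁ vs₂ assoc flat-s s≡)
    where assoc = subst IsAssoc (sym isA) tt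
  Invariant-step (DecC _ _ _ P↭ fresh₁ fresh₂ Y₁≢Y₂) =
    Invariant-split P↭ fresh₁ fresh₂ Y₁≢Y₂ Splits-neapp Splits-neapp
  Invariant-step (DecC' _ _ isC P↭ fresh₁ fresh₂ Y₁≢Y₂) =
    Invariant-split P↭ fresh₁ fresh₂ Y₁≢Y₂ Splits-neapp (Splits-neapp-swap (subst IsComm (sym isC) tt))
  Invariant-step (DecAC _ _ _ _ _ _ isAC P↭ flat-t t↭ flat-s s↭ fresh₁ fresh₂ Y₁≢Y₂) =
    Invariant-split P↭ fresh₁ fresh₂ Y₁≢Y₂
      (Splits-FlatAC assoc comm flat-t t↭) (Splits-FlatAC assoc comm flat-s s↭)
    where assoc = subst IsAssoc (sym isAC) tt
          comm  = subst IsComm (sym isAC) tt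

  Invariant-steps : ∀ {sd G X st st′} → TransClosure _⇒_ st st′ →
                    Invariant sd G X st → Invariant sd G X st′
  Invariant-steps Plus.[ s ] = Invariant-step s
  Invariant-steps (s ∷ ss)   = Invariant-steps ss ∘ Invariant-step s

  generalizes : ∀ sd ∇ {s t X S Γ σ} → ¬ OccT (tvar X) s → ¬ OccT (tvar X) t →
    TransClosure _⇒_ ⟨ (X ∶ t ≜ s) ∷ [] , [] , [] , Id ⟩ ⟨ [] , S , Γ , σ ⟩ →
    (∇ , pick sd t s) ⊆⟦⟧ (Γ , tv σ X)
  generalizes sd ∇ {s} {t} {X} X∉s X∉t derivation _ (ρ₀ , _ , side≈) =
    case Invariant-steps derivation (inv₀ , ρ , w₀) of λ where
      (_ , ρ′ , w) → ρ′ , context w , ≈trans (root w) side≈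
    where
    G  = ⟦ pick sd t s ⟧T ρ₀
    ρ  = updateT ρ₀ X G
    X↦ : tρ ρ X ≡ G
    X↦ = if-≟-≡ X X refl
    inv₀ : RootInv X ((X ∶ t ≜ s) ∷ []) Id
    inv₀ = pending ((X∉t , X∉s) ∷ []) (λ _ → t , s , refl)
    w₀ : Witness sd G X ⟨ (X ∶ t ≜ s) ∷ [] , [] , [] , Id ⟩ ρ
    w₀ = witness [] (≡⇒≈E (trans (actG-id _) X↦))
      (≈trans (≡⇒≈E X↦) (⟦⟧T-agree (pick sd t s)
        (Agree-mono (λ {v} → pick-⊎ (OccT v) sd) (updateT-agree [ X∉t , X∉s ]))) ∷ [])
      []

mainTheorem2 : (Sg : Signature) → let open Lang Sg in
    (∇ : Ctx) (s t : Term) (X : ℕ) →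
    ¬ Any (OccFC (tvar X)) ∇ → ¬ OccT (tvar X) s → ¬ OccT (tvar X) t →
    (S : List SEq) (Γ : Ctx) (σ : Subst) →
    TransClosure _⇒_ ⟨ (X ∶ t ≜ s) ∷ [] , [] , [] , Id ⟩ ⟨ [] , S , Γ , σ ⟩ →
    IsEGeneralization (Γ , tv σ X) (∇ , t) (∇ , s)
mainTheorem2 Sg ∇ s t X _ X∉s X∉t S Γ σ derivation =
  generalizes Sg left ∇ X∉s X∉t derivation , generalizes Sg right ∇ X∉s X∉t derivation
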